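{- Let $n\geq 1$ and $0\leq t\leq\binom{n}{2}$ be integers, and let $I_n(t)$ be the number of permutations of $\{1,\ldots,n\}$ with exactly $t$ inversions. For $1\leq j\leq n$ and $\binom{j+1}{2}\leq k\leq\binom{n+1}{2}$ let $C(n,j,k)=[q^{\,k-\binom{j+1}{2}}]\Big[{n\atop j}\Big]_q$ be the coefficient of $q^{k-\binom{j+1}{2}}$ in the Gaussian polynomial $\Big[{n\atop j}\Big]_q$. Then $$I_n(t)=\binom{n+t}{t}-\binom{n+t-1}{t-1}+\sum_{j=1}^n\ \sum_{k=\binom{j+1}{2}}^{\binom{n+1}{2}}(-1)^j\,C(n,j,k)\left(\binom{t-k+n}{n}_0-\binom{t-k+n-1}{n}_0\right).$$
   Context: An inversion of a permutation $(a_1,\ldots,a_n)$ is a pair $(a_i,a_j)$ with $i<j$ and $a_i>a_j$. The binomial coefficient $\binom{a}{ -1}$ is taken to be $0$. The restricted binomial coefficient is $\binom{a}{k}_0=\binom{a}{k}$ if $a\geq k$ and $0$ otherwise. The $q$-factorial is $[m]_q!=(1+q)(1+q+q^2)\cdots(1+q+\cdots+q^{m-1})$ (with $[0]_q!=[1]_q!=1$), and $\Big[{n\atop m}\Big]_q=\frac{[n]_q!}{[n-m]_q!\,[m]_q!}$ is the Gaussian polynomial. -}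

module Defs where

open import Data.Nat using (ℕ; zero; suc; _+_; _*_; _∸_; _<?_; _≤?_; _≟_)
open import Data.Nat.Combinatorics using (_C_)
open import Data.Integer as ℤ using (ℤ; +_; -[1+_])
open import Data.Fin as Fin using (Fin; toℕ)
import Data.Fin.Properties as FinP
open import Data.List using (List; []; _∷_; length; filter; map; concatMap; allFin; upTo; sum; foldr; _++_; [_])
open import Relation.Nullary.Decidable using (does)
import Data.List.Relation.Unary.Unique.DecPropositional
open import Data.Bool using (if_then_else_)

allSeqs : (m n : ℕ) → List (List (Fin n))
allSeqs zero    n = [] ∷ []
allSeqs (suc m) n = concatMap (λ x → map (x ∷_) (allSeqs m n)) (allFin n)

-- permutations of {0,…,n-1} (≅ {1,…,n}) as the sequences (a₁,…,aₙ)
-- of length n with pairwise distinct entries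
module U {n : ℕ} = Data.List.Relation.Unary.Unique.DecPropositional (FinP._≟_ {n})

permutations : (n : ℕ) → List (List (Fin n))
permutations n = filter (U.unique? {n}) (allSeqs n n)

inversions : {n : ℕ} → List (Fin n) → ℕ
inversions []       = 0
inversions (x ∷ xs) = length (filter (λ y → toℕ y <? toℕ x) xs) + inversions xs

I : ℕ → ℕ → ℕ
I n t = length (filter (λ p → inversions p ≟ t) (permutations n))

binomM1 : ℕ → ℕ → ℕ          -- binomM1 a t  represents  binom(a , t - 1)
binomM1 a zero    = 0
binomM1 a (suc s) = a C s

-- restricted binomial: binom(a,k)₀ = binom(a,k) if a ≥ k, else 0 (a ∈ ℤ)
rbinom : ℤ → ℕ → ℕ
rbinom (+ a)    k = if does (k ≤? a) then a C k else 0
rbinom -[1+ _ ] k = 0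

-- Polynomials as coefficient lists (lowest degree first)

Poly : Set
Poly = List ℤ

coeff : Poly → ℕ → ℤ
coeff []       _       = + 0
coeff (a ∷ _)  zero    = a
coeff (_ ∷ as) (suc k) = coeff as k

_⊕_ : Poly → Poly → Poly
[]       ⊕ q        = q
(a ∷ p)  ⊕ []       = a ∷ p
(a ∷ p)  ⊕ (b ∷ q)  = (a ℤ.+ b) ∷ (p ⊕ q)

scale : ℤ → Poly → Poly
scale c = map (c ℤ.*_)

_⊗_ : Poly → Poly → Poly
[]      ⊗ q = []
(a ∷ p) ⊗ q = scale a q ⊕ (+ 0 ∷ (p ⊗ q))

qint : ℕ → Poly
qint m = map (λ _ → + 1) (upTo m)

qfact : ℕ → Poly
qfact zero    = + 1 ∷ []
qfact (suc m) = qfact m ⊗ qint (suc m)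

-- Division A / B of polynomials with B(0) = 1, as formal power series:
-- first (k+1) coefficients c₀…c_k of the quotient, given by
--   c_k = a_k - Σ_{i=1}^{k} b_i c_{k-i}.
-- (If B divides A, these are the coefficients of the polynomial A/B.)
private
  conv : Poly → List ℤ → ℕ → ℤ
  conv b cs k = foldr ℤ._+_ (+ 0) (map (λ i → coeff b (suc i) ℤ.* coeff cs (k ∸ suc i)) (upTo k))

divCoeffs : Poly → Poly → ℕ → List ℤ
divCoeffs a b zero    = coeff a 0 ∷ []
divCoeffs a b (suc k) = let cs = divCoeffs a b k in
                        cs ++ [ coeff a (suc k) ℤ.- conv b cs (suc k) ]

divCoeff : Poly → Poly → ℕ → ℤ
divCoeff a b k = coeff (divCoeffs a b k) k

gaussCoeff : ℕ → ℕ → ℕ → ℤ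
gaussCoeff n m k = divCoeff (qfact n) (qfact (n ∸ m) ⊗ qfact m) k

Cnjk : ℕ → ℕ → ℕ → ℤ
Cnjk n j k = gaussCoeff n j (k ∸ (suc j C 2))

-- Σ_{i=a}^{b} f i  (empty if b < a)
Σ[_⋯_] : ℕ → ℕ → (ℕ → ℤ) → ℤ
Σ[ a ⋯ b ] f = foldr ℤ._+_ (+ 0) (map (λ i → f (a + i)) (upTo (suc b ∸ a)))

sign : ℕ → ℤ
sign zero    = + 1
sign (suc j) = ℤ.- sign j

-- A permutation of {0, …, n - 1} is recorded by its first entry x and the remaining entries,
-- relabelled into {0, …, n - 2} by punchIn x; the entry x is inverted with exactly x later entries,
-- so the inversion generating function is [ n ]_q ! = ∏ᵢ₌₁ⁿ [ i ]_q. Since [ i ]_q (1 - q) = 1 - qⁱ,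
-- this equals (1 - q) ⋯ (1 - qⁿ) · (1 - q) ^ (- n), and the q-binomial theorem expands the product
-- as ∑ⱼ (-1) ^ j q ^ (j (j + 1) / 2) [ n choose j ]_q. The coefficient of qᵗ in (1 - q) ^ (- n) is
-- binom(n - 1 + t, t), which is the leading term of the formula, and the difference of restricted
-- binomials is [k ≤ t] binom(n - 1 + t - k, t - k); since t ≤ binom(n + 1, 2), the range of k
-- catches every term of the resulting convolution.

module Submission where

module PowerSeries where

  open import Data.Nat using (ℕ; zero; suc; _∸_)
  import Data.Nat as ℕ
  open import Data.Integer using (ℤ; +_; _+_; _*_; -_)
  import Data.Integer.Properties as ℤ
  open import Data.Integer.Tactic.RingSolver using (solve-∀)
  open import Function using (_∘_)
  open import Relation.Binary.PropositionalEquality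

  Series : Set
  Series = ℕ → ℤ

  infixl 6 _⊞_
  infixl 7 _⊠_ _·_
  infix  8 ⊟_

  𝟎 𝟏 : Series
  𝟎 _       = + 0
  𝟏 zero    = + 1
  𝟏 (suc _) = + 0

  _⊞_ : Series → Series → Series
  (a ⊞ b) k = a k + b k

  _·_ : ℤ → Series → Series
  (c · a) k = c * a k

  ⊟_ : Series → Series
  (⊟ a) k = - a k

  shift : Series → Series
  shift a zero    = + 0
  shift a (suc k) = a k

  shiftBy : ℕ → Series → Series
  shiftBy zero    a = a
  shiftBy (suc m) a = shift (shiftBy m a)

  _⊠_ : Series → Series → Series
  (a ⊠ b) zero    = a 0 * b 0
  (a ⊠ b) (suc k) = a 0 * b (suc k) + ((a ∘ suc) ⊠ b) k

  ∑< : ℕ → (ℕ → ℤ) → ℤ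
  ∑< zero    f = + 0
  ∑< (suc m) f = f 0 + ∑< m (f ∘ suc)

  infix 5 ∑<
  syntax ∑< m (λ i → e) = ∑[ i < m ] e

  ⊞-cong : ∀ {a a′ b b′} → a ≗ a′ → b ≗ b′ → a ⊞ b ≗ a′ ⊞ b′
  ⊞-cong p q k = cong₂ _+_ (p k) (q k)

  shift-cong : ∀ {a a′} → a ≗ a′ → shift a ≗ shift a′
  shift-cong p zero    = refl
  shift-cong p (suc k) = p k

  shiftBy-cong : ∀ m {a a′} → a ≗ a′ → shiftBy m a ≗ shiftBy m a′
  shiftBy-cong zero    p = p
  shiftBy-cong (suc m) p = shift-cong (shiftBy-cong m p)

  ⊠-cong : ∀ {a a′ b b′} → a ≗ a′ → b ≗ b′ → a ⊠ b ≗ a′ ⊠ b′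
  ⊠-cong p q zero    = cong₂ _*_ (p 0) (q 0)
  ⊠-cong p q (suc k) = cong₂ _+_ (cong₂ _*_ (p 0) (q (suc k))) (⊠-cong (p ∘ suc) q k)

  ⊠-congˡ : ∀ {a a′} b → a ≗ a′ → a ⊠ b ≗ a′ ⊠ b
  ⊠-congˡ b p = ⊠-cong p (λ _ → refl)

  ⊠-congʳ : ∀ a {b b′} → b ≗ b′ → a ⊠ b ≗ a ⊠ b′
  ⊠-congʳ a = ⊠-cong (λ _ → refl)

  ⊠-as-∑ : ∀ a b k → (a ⊠ b) k ≡ ∑[ i < suc k ] (a i * b (k ∸ i))
  ⊠-as-∑ a b zero    = sym (ℤ.+-identityʳ _)
  ⊠-as-∑ a b (suc k) = cong (λ x → a 0 * b (suc k) + x) (⊠-as-∑ (a ∘ suc) b k)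

  ⊠-unfoldˡ : ∀ a b → a ⊠ b ≗ a 0 · b ⊞ shift ((a ∘ suc) ⊠ b)
  ⊠-unfoldˡ a b zero    = sym (ℤ.+-identityʳ _)
  ⊠-unfoldˡ a b (suc k) = refl

  ⊠-zeroˡ : ∀ b → 𝟎 ⊠ b ≗ 𝟎
  ⊠-zeroˡ b zero    = refl
  ⊠-zeroˡ b (suc k) = trans (cong (λ x → + 0 * b (suc k) + x) (⊠-zeroˡ b k)) (ℤ.*-zeroˡ (b (suc k)))

  ⊠-identityˡ : ∀ b → 𝟏 ⊠ b ≗ b
  ⊠-identityˡ b zero    = ℤ.*-identityˡ (b 0)
  ⊠-identityˡ b (suc k) = begin
    + 1 * b (suc k) + (𝟎 ⊠ b) k ≡⟨ cong₂ _+_ (ℤ.*-identityˡ (b (suc k))) (⊠-zeroˡ b k) ⟩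
    b (suc k) + + 0             ≡⟨ ℤ.+-identityʳ _ ⟩
    b (suc k)                   ∎
    where open ≡-Reasoning

  ⊠-distribʳ-⊞ : ∀ a a′ b → (a ⊞ a′) ⊠ b ≗ a ⊠ b ⊞ a′ ⊠ b
  ⊠-distribʳ-⊞ a a′ b zero    = ℤ.*-distribʳ-+ (b 0) (a 0) (a′ 0)
  ⊠-distribʳ-⊞ a a′ b (suc k) =
    trans (cong (λ x → (a 0 + a′ 0) * b (suc k) + x) (⊠-distribʳ-⊞ (a ∘ suc) (a′ ∘ suc) b k))
          (rearrange (a 0) (a′ 0) (b (suc k)) _ _)
    where
    rearrange : ∀ x y z u v → (x + y) * z + (u + v) ≡ (x * z + u) + (y * z + v)
    rearrange = solve-∀

  ⊠-distribˡ-⊞ : ∀ a b b′ → a ⊠ (b ⊞ b′) ≗ a ⊠ b ⊞ a ⊠ b′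
  ⊠-distribˡ-⊞ a b b′ zero    = ℤ.*-distribˡ-+ (a 0) (b 0) (b′ 0)
  ⊠-distribˡ-⊞ a b b′ (suc k) =
    trans (cong (λ x → a 0 * (b (suc k) + b′ (suc k)) + x) (⊠-distribˡ-⊞ (a ∘ suc) b b′ k))
          (rearrange (a 0) (b (suc k)) (b′ (suc k)) _ _)
    where
    rearrange : ∀ x y z u v → x * (y + z) + (u + v) ≡ (x * y + u) + (x * z + v)
    rearrange = solve-∀

  ·-⊠-assoc : ∀ c a b → c · a ⊠ b ≗ c · (a ⊠ b)
  ·-⊠-assoc c a b zero    = ℤ.*-assoc c (a 0) (b 0)
  ·-⊠-assoc c a b (suc k) =
    trans (cong (λ x → c * a 0 * b (suc k) + x) (·-⊠-assoc c (a ∘ suc) b k)) (factor c (a 0) (b (suc k)) _)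
    where
    factor : ∀ c x y u → c * x * y + c * u ≡ c * (x * y + u)
    factor = solve-∀

  shift-⊠ : ∀ a b → shift a ⊠ b ≗ shift (a ⊠ b)
  shift-⊠ a b zero    = ℤ.*-zeroˡ (b 0)
  shift-⊠ a b (suc k) = trans (cong (_+ (a ⊠ b) k) (ℤ.*-zeroˡ (b (suc k)))) (ℤ.+-identityˡ _)

  ⊠-comm : ∀ a b → a ⊠ b ≗ b ⊠ a
  ⊠-comm a b zero          = ℤ.*-comm (a 0) (b 0)
  ⊠-comm a b (suc zero)    = swap (a 0) (b 1) (a 1) (b 0)
    where
    swap : ∀ x y z w → x * y + z * w ≡ w * z + y * x
    swap = solve-∀
  ⊠-comm a b (suc (suc k)) = begin
    a 0 * b (suc (suc k)) + ((a ∘ suc) ⊠ b) (suc k)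
      ≡⟨ cong (λ x → a 0 * b (suc (suc k)) + x) (⊠-comm (a ∘ suc) b (suc k)) ⟩
    a 0 * b (suc (suc k)) + (b 0 * a (suc (suc k)) + ((b ∘ suc) ⊠ (a ∘ suc)) k)
      ≡⟨ cong (λ x → a 0 * b (suc (suc k)) + (b 0 * a (suc (suc k)) + x)) (⊠-comm (b ∘ suc) (a ∘ suc) k) ⟩
    a 0 * b (suc (suc k)) + (b 0 * a (suc (suc k)) + ((a ∘ suc) ⊠ (b ∘ suc)) k)
      ≡⟨ exchange (a 0) (b (suc (suc k))) (b 0) (a (suc (suc k))) _ ⟩
    b 0 * a (suc (suc k)) + (a 0 * b (suc (suc k)) + ((a ∘ suc) ⊠ (b ∘ suc)) k)
      ≡⟨ cong (λ x → b 0 * a (suc (suc k)) + x) (⊠-comm (b ∘ suc) a (suc k)) ⟨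
    b 0 * a (suc (suc k)) + ((b ∘ suc) ⊠ a) (suc k) ∎
    where
    open ≡-Reasoning
    exchange : ∀ x y z w u → x * y + (z * w + u) ≡ z * w + (x * y + u)
    exchange = solve-∀

  ⊠-assoc : ∀ a b c → (a ⊠ b) ⊠ c ≗ a ⊠ (b ⊠ c)
  ⊠-assoc a b c k = trans (unfold k) (fold k)
    where
    unfold : ∀ k → ((a ⊠ b) ⊠ c) k ≡ a 0 * (b ⊠ c) k + shift (((a ∘ suc) ⊠ b) ⊠ c) k
    unfold k = trans (⊠-congˡ c (⊠-unfoldˡ a b) k)
              (trans (⊠-distribʳ-⊞ (a 0 · b) (shift ((a ∘ suc) ⊠ b)) c k)
                     (cong₂ _+_ (·-⊠-assoc (a 0) b c k) (shift-⊠ ((a ∘ suc) ⊠ b) c k)))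
    fold : ∀ k → a 0 * (b ⊠ c) k + shift (((a ∘ suc) ⊠ b) ⊠ c) k ≡ (a ⊠ (b ⊠ c)) k
    fold zero    = ℤ.+-identityʳ _
    fold (suc k) = cong (λ x → a 0 * (b ⊠ c) (suc k) + x) (⊠-assoc (a ∘ suc) b c k)

  ⊠-swapʳ : ∀ a b c → a ⊠ b ⊠ c ≗ a ⊠ c ⊠ b
  ⊠-swapʳ a b c k = trans (⊠-assoc a b c k)
                          (trans (⊠-congʳ a (⊠-comm b c) k) (sym (⊠-assoc a c b k)))


  ⊠-identityʳ : ∀ a → a ⊠ 𝟏 ≗ a
  ⊠-identityʳ a k = trans (⊠-comm a 𝟏 k) (⊠-identityˡ a k)

  ⊠-zeroʳ : ∀ a → a ⊠ 𝟎 ≗ 𝟎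
  ⊠-zeroʳ a k = trans (⊠-comm a 𝟎 k) (⊠-zeroˡ a k)

  ⊠-⊟ : ∀ a b → a ⊠ ⊟ b ≗ ⊟ (a ⊠ b)
  ⊠-⊟ a b zero    = sym (ℤ.neg-distribʳ-* (a 0) (b 0))
  ⊠-⊟ a b (suc k) =
    trans (cong (λ x → a 0 * - b (suc k) + x) (⊠-⊟ (a ∘ suc) b k)) (negate (a 0) (b (suc k)) _)
    where
    negate : ∀ x y r → x * - y + - r ≡ - (x * y + r)
    negate = solve-∀

  shift-𝟎 : shift 𝟎 ≗ 𝟎
  shift-𝟎 zero    = refl
  shift-𝟎 (suc k) = refl

  shiftBy-𝟎 : ∀ m → shiftBy m 𝟎 ≗ 𝟎
  shiftBy-𝟎 zero    k = refl
  shiftBy-𝟎 (suc m) k = trans (shift-cong (shiftBy-𝟎 m) k) (shift-𝟎 k)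

  shiftBy-+ : ∀ m p a → shiftBy m (shiftBy p a) ≗ shiftBy (m ℕ.+ p) a
  shiftBy-+ zero    p a k = refl
  shiftBy-+ (suc m) p a k = shift-cong (shiftBy-+ m p a) k

  shiftBy-⊞ : ∀ m a b → shiftBy m (a ⊞ b) ≗ shiftBy m a ⊞ shiftBy m b
  shiftBy-⊞ zero    a b k       = refl
  shiftBy-⊞ (suc m) a b zero    = refl
  shiftBy-⊞ (suc m) a b (suc k) = shiftBy-⊞ m a b k

  shiftBy-· : ∀ m c a → shiftBy m (c · a) ≗ c · shiftBy m a
  shiftBy-· zero    c a k       = refl
  shiftBy-· (suc m) c a zero    = sym (ℤ.*-zeroʳ c)
  shiftBy-· (suc m) c a (suc k) = shiftBy-· m c a k

  shiftBy-⊠ : ∀ m a b → shiftBy m a ⊠ b ≗ shiftBy m (a ⊠ b)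
  shiftBy-⊠ zero    a b k = refl
  shiftBy-⊠ (suc m) a b k = trans (shift-⊠ (shiftBy m a) b k) (shift-cong (shiftBy-⊠ m a b) k)

  ⊠-shiftBy : ∀ m a b → a ⊠ shiftBy m b ≗ shiftBy m (a ⊠ b)
  ⊠-shiftBy m a b k = trans (⊠-comm a (shiftBy m b) k)
                            (trans (shiftBy-⊠ m b a k) (shiftBy-cong m (⊠-comm b a) k))

  shiftBy-+ˡ : ∀ m a k → shiftBy m a (m ℕ.+ k) ≡ a k
  shiftBy-+ˡ zero    a k = refl
  shiftBy-+ˡ (suc m) a k = shiftBy-+ˡ m a k

  shiftBy-< : ∀ m a {k} → k ℕ.< m → shiftBy m a k ≡ + 0
  shiftBy-< (suc m) a {zero}  _           = refl
  shiftBy-< (suc m) a {suc k} (ℕ.s≤s k<m) = shiftBy-< m a k<m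

  ∑-cong : ∀ m {f g} → (∀ i → f i ≡ g i) → ∑< m f ≡ ∑< m g
  ∑-cong zero    e = refl
  ∑-cong (suc m) e = cong₂ _+_ (e 0) (∑-cong m (e ∘ suc))

  ∑-cong< : ∀ m {f g} → (∀ i → i ℕ.< m → f i ≡ g i) → ∑< m f ≡ ∑< m g
  ∑-cong< zero    e = refl
  ∑-cong< (suc m) e = cong₂ _+_ (e 0 (ℕ.s≤s ℕ.z≤n)) (∑-cong< m (λ i p → e (suc i) (ℕ.s≤s p)))

  ∑-zero : ∀ m → ∑[ i < m ] + 0 ≡ + 0
  ∑-zero zero    = refl
  ∑-zero (suc m) = trans (ℤ.+-identityˡ _) (∑-zero m)

  ∑-distrib-+ : ∀ m f g → ∑[ i < m ] (f i + g i) ≡ ∑< m f + ∑< m g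
  ∑-distrib-+ zero    f g = refl
  ∑-distrib-+ (suc m) f g =
    trans (cong (λ x → f 0 + g 0 + x) (∑-distrib-+ m (f ∘ suc) (g ∘ suc)))
          (interchange (f 0) (g 0) (∑< m (f ∘ suc)) (∑< m (g ∘ suc)))
    where
    interchange : ∀ a b c d → a + b + (c + d) ≡ a + c + (b + d)
    interchange = solve-∀

  ∑-neg : ∀ m f → ∑[ i < m ] (- f i) ≡ - ∑< m f
  ∑-neg zero    f = refl
  ∑-neg (suc m) f = trans (cong (λ x → - f 0 + x) (∑-neg m (f ∘ suc)))
                          (sym (ℤ.neg-distrib-+ (f 0) (∑< m (f ∘ suc))))

  *-distribˡ-∑ : ∀ c m f → ∑[ i < m ] (c * f i) ≡ c * ∑< m f
  *-distribˡ-∑ c zero    f = sym (ℤ.*-zeroʳ c)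
  *-distribˡ-∑ c (suc m) f = trans (cong (λ x → c * f 0 + x) (*-distribˡ-∑ c m (f ∘ suc)))
                                   (sym (ℤ.*-distribˡ-+ c (f 0) (∑< m (f ∘ suc))))

  ∑-last : ∀ m f → ∑< (suc m) f ≡ ∑< m f + f m
  ∑-last zero    f = trans (ℤ.+-identityʳ (f 0)) (sym (ℤ.+-identityˡ (f 0)))
  ∑-last (suc m) f = trans (cong (λ x → f 0 + x) (∑-last m (f ∘ suc)))
                           (sym (ℤ.+-assoc (f 0) (∑< m (f ∘ suc)) (f (suc m))))

  ∑ˢ : ℕ → (ℕ → Series) → Series
  ∑ˢ m f k = ∑[ j < m ] f j k

  shiftBy-∑ˢ : ∀ m p f → shiftBy m (∑ˢ p f) ≗ ∑ˢ p (λ j → shiftBy m (f j))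
  shiftBy-∑ˢ zero    p f k       = refl
  shiftBy-∑ˢ (suc m) p f zero    = sym (∑-zero p)
  shiftBy-∑ˢ (suc m) p f (suc k) = shiftBy-∑ˢ m p f k

  ∑ˢ-⊠ : ∀ m f b → ∑ˢ m f ⊠ b ≗ ∑ˢ m (λ j → f j ⊠ b)
  ∑ˢ-⊠ zero    f b k = ⊠-zeroˡ b k
  ∑ˢ-⊠ (suc m) f b k = trans (⊠-distribʳ-⊞ (f 0) (∑ˢ m (f ∘ suc)) b k)
                             (cong (λ x → (f 0 ⊠ b) k + x) (∑ˢ-⊠ m (f ∘ suc) b k))

module PolynomialCoefficients where

  open import Data.Nat using (ℕ; zero; suc; _∸_; _≤_; _<_; s≤s; _⊓_)
  import Data.Nat.Properties as ℕ
  open import Data.Integer using (ℤ; +_; _+_; _*_; _-_)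
  import Data.Integer.Properties as ℤ
  open import Data.Integer.Tactic.RingSolver using (solve-∀)
  open import Data.List using (List; []; _∷_; map; foldr; applyUpTo; upTo; length; _++_; [_])
  import Data.List.Properties as List
  open import Data.Sum using (inj₁; inj₂)
  open import Function using (_∘_; id)
  open import Relation.Binary.PropositionalEquality hiding ([_])
  open import Defs
  open PowerSeries

  coeff-⊕ : ∀ p q → coeff (p ⊕ q) ≗ coeff p ⊞ coeff q
  coeff-⊕ []      q       k       = sym (ℤ.+-identityˡ _)
  coeff-⊕ (a ∷ p) []      k       = sym (ℤ.+-identityʳ _)
  coeff-⊕ (a ∷ p) (b ∷ q) zero    = refl
  coeff-⊕ (a ∷ p) (b ∷ q) (suc k) = coeff-⊕ p q k

  coeff-scale : ∀ c p → coeff (scale c p) ≗ c · coeff p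
  coeff-scale c []      k       = sym (ℤ.*-zeroʳ c)
  coeff-scale c (a ∷ p) zero    = refl
  coeff-scale c (a ∷ p) (suc k) = coeff-scale c p k

  coeff-⊗ : ∀ p q → coeff (p ⊗ q) ≗ coeff p ⊠ coeff q
  coeff-⊗ []      q k = sym (⊠-zeroˡ (coeff q) k)
  coeff-⊗ (a ∷ p) q k = begin
    coeff (scale a q ⊕ (+ 0 ∷ p ⊗ q)) k               ≡⟨ coeff-⊕ (scale a q) (+ 0 ∷ p ⊗ q) k ⟩
    coeff (scale a q) k + coeff (+ 0 ∷ p ⊗ q) k       ≡⟨ cong₂ _+_ (coeff-scale a q k) (shifted k) ⟩
    (a · coeff q ⊞ shift (coeff p ⊠ coeff q)) k       ≡⟨ ⊠-unfoldˡ (coeff (a ∷ p)) (coeff q) k ⟨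
    (coeff (a ∷ p) ⊠ coeff q) k                       ∎
    where
    open ≡-Reasoning
    shifted : coeff (+ 0 ∷ p ⊗ q) ≗ shift (coeff p ⊠ coeff q)
    shifted zero    = refl
    shifted (suc k) = coeff-⊗ p q k

  foldr-+-applyUpTo : ∀ (h : ℕ → ℤ) f m → foldr _+_ (+ 0) (map h (applyUpTo f m)) ≡ ∑< m (h ∘ f)
  foldr-+-applyUpTo h f zero    = refl
  foldr-+-applyUpTo h f (suc m) = cong (λ x → h (f 0) + x) (foldr-+-applyUpTo h (f ∘ suc) m)

  qintˢ : ℕ → Series
  qintˢ zero    k       = + 0
  qintˢ (suc m) zero    = + 1
  qintˢ (suc m) (suc k) = qintˢ m k

  qfactˢ : ℕ → Series
  qfactˢ zero    = 𝟏
  qfactˢ (suc m) = qfactˢ m ⊠ qintˢ (suc m)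

  coeff-qint : ∀ m → coeff (qint m) ≗ qintˢ m
  coeff-qint m = go m id
    where
    go : ∀ m f → coeff (map (λ _ → + 1) (applyUpTo f m)) ≗ qintˢ m
    go zero    f k       = refl
    go (suc m) f zero    = refl
    go (suc m) f (suc k) = go m (f ∘ suc) k

  coeff-qfact : ∀ m → coeff (qfact m) ≗ qfactˢ m
  coeff-qfact zero    zero    = refl
  coeff-qfact zero    (suc k) = refl
  coeff-qfact (suc m) k       = trans (coeff-⊗ (qfact m) (qint (suc m)) k)
                                      (⊠-cong (coeff-qfact m) (coeff-qint (suc m)) k)

  qfactˢ-constant : ∀ m → qfactˢ m 0 ≡ + 1
  qfactˢ-constant zero    = refl
  qfactˢ-constant (suc m) = cong (_* + 1) (qfactˢ-constant m)

  qintˢ-+ : ∀ m p → qintˢ (m Data.Nat.+ p) ≗ qintˢ m ⊞ shiftBy m (qintˢ p)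
  qintˢ-+ zero    p k       = sym (ℤ.+-identityˡ _)
  qintˢ-+ (suc m) p zero    = refl
  qintˢ-+ (suc m) p (suc k) = qintˢ-+ m p k

  qintˢ-≤ : ∀ {k t} → k ≤ t → qintˢ (suc t) k ≡ + 1
  qintˢ-≤ {zero}  _         = refl
  qintˢ-≤ {suc k} (s≤s k≤t) = qintˢ-≤ k≤t

  qintˢ-> : ∀ {k t} → t < k → qintˢ (suc t) k ≡ + 0
  qintˢ-> {suc k} {zero}  _         = refl
  qintˢ-> {suc k} {suc t} (s≤s t<k) = qintˢ-> t<k

  qintˢ-shift : ∀ a m i → qintˢ (suc (a Data.Nat.+ m)) (a Data.Nat.+ i) ≡ qintˢ (suc m) i
  qintˢ-shift zero    m i = refl
  qintˢ-shift (suc a) m i = qintˢ-shift a m i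

  ∑-qintˢ : ∀ a b g → ∑[ i < b ] (qintˢ a i * g i) ≡ ∑< (a ⊓ b) g
  ∑-qintˢ zero    b       g = trans (∑-cong b (λ i → ℤ.*-zeroˡ (g i))) (∑-zero b)
  ∑-qintˢ (suc a) zero    g = refl
  ∑-qintˢ (suc a) (suc b) g = cong₂ _+_ (ℤ.*-identityˡ (g 0)) (∑-qintˢ a b (g ∘ suc))

  ∑-qintˢ-comm : ∀ a b g → ∑[ i < b ] (qintˢ a i * g i) ≡ ∑[ i < a ] (qintˢ b i * g i)
  ∑-qintˢ-comm a b g = trans (∑-qintˢ a b g) (trans (cong (λ m → ∑< m g) (ℕ.⊓-comm a b)) (sym (∑-qintˢ b a g)))

  length-divCoeffs : ∀ a b k → length (divCoeffs a b k) ≡ suc k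
  length-divCoeffs a b zero    = refl
  length-divCoeffs a b (suc k) = begin
    length (divCoeffs a b k ++ _)          ≡⟨ List.length-++ (divCoeffs a b k) ⟩
    length (divCoeffs a b k) Data.Nat.+ 1  ≡⟨ ℕ.+-comm (length (divCoeffs a b k)) 1 ⟩
    suc (length (divCoeffs a b k))         ≡⟨ cong suc (length-divCoeffs a b k) ⟩
    suc (suc k)                            ∎
    where open ≡-Reasoning

  coeff-++ˡ : ∀ (xs ys : Poly) {i} → i < length xs → coeff (xs ++ ys) i ≡ coeff xs i
  coeff-++ˡ (x ∷ xs) ys {zero}  _         = refl
  coeff-++ˡ (x ∷ xs) ys {suc i} (s≤s i<n) = coeff-++ˡ xs ys i<n

  coeff-∷ʳ-length : ∀ (xs : Poly) y → coeff (xs ++ [ y ]) (length xs) ≡ y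
  coeff-∷ʳ-length []       y = refl
  coeff-∷ʳ-length (x ∷ xs) y = coeff-∷ʳ-length xs y

  module _ (a b : Poly) (g : Series) (b₀≡1 : coeff b 0 ≡ + 1) (a≗b⊠g : coeff a ≗ coeff b ⊠ g) where

    divCoeffs-correct : ∀ k {i} → i ≤ k → coeff (divCoeffs a b k) i ≡ g i
    divCoeffs-correct zero    {zero} _ = trans (a≗b⊠g 0) (trans (cong (_* g 0) b₀≡1) (ℤ.*-identityˡ (g 0)))
    divCoeffs-correct (suc k) {i} i≤1+k with ℕ.m≤n⇒m<n∨m≡n i≤1+k
    ... | inj₁ (s≤s i≤k) = trans (coeff-++ˡ cs _ (subst (i <_) (sym (length-divCoeffs a b k)) (s≤s i≤k)))
                                 (divCoeffs-correct k i≤k)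
      where
      cs : Poly
      cs = divCoeffs a b k
    ... | inj₂ refl = begin
      coeff (cs ++ [ new ]) (suc k)            ≡⟨ cong (coeff (cs ++ [ new ])) (length-divCoeffs a b k) ⟨
      coeff (cs ++ [ new ]) (length cs)        ≡⟨ coeff-∷ʳ-length cs new ⟩
      coeff a (suc k) - convolution            ≡⟨ cong₂ _-_ a₁₊ₖ convolution≡tail ⟩
      g (suc k) + tail - tail                  ≡⟨ cancel (g (suc k)) tail ⟩
      g (suc k)                                ∎
      where
      open ≡-Reasoning
      cs : Poly
      cs = divCoeffs a b k
      convolution : ℤ
      convolution = foldr _+_ (+ 0) (map (λ j → coeff b (suc j) * coeff cs (suc k ∸ suc j)) (upTo (suc k)))
      new : ℤ
      new = coeff a (suc k) - convolution
      tail : ℤ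
      tail = ∑[ j < suc k ] (coeff b (suc j) * g (k ∸ j))
      convolution≡tail : convolution ≡ tail
      convolution≡tail = trans (foldr-+-applyUpTo (λ j → coeff b (suc j) * coeff cs (suc k ∸ suc j)) id (suc k))
        (∑-cong (suc k) (λ j → cong (coeff b (suc j) *_) (divCoeffs-correct k (ℕ.m∸n≤m k j))))
      a₁₊ₖ : coeff a (suc k) ≡ g (suc k) + tail
      a₁₊ₖ = trans (a≗b⊠g (suc k))
        (cong₂ _+_ (trans (cong (_* g (suc k)) b₀≡1) (ℤ.*-identityˡ _)) (⊠-as-∑ (coeff b ∘ suc) g k))
      cancel : ∀ x y → x + y - y ≡ x
      cancel = solve-∀

    divCoeff-correct : ∀ k → divCoeff a b k ≡ g k
    divCoeff-correct k = divCoeffs-correct k ℕ.≤-refl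


module GaussianPolynomials where

  open import Data.Nat using (ℕ; zero; suc; _∸_; _≤_; _<_; s≤s)
  import Data.Nat.Properties as ℕ
  open import Data.Integer using (ℤ; +_; _+_; _*_)
  open import Data.Sum using (inj₁; inj₂)
  open import Relation.Binary.PropositionalEquality
  import Relation.Binary.Reasoning.Setoid as SetoidReasoning
  open import Defs using (qfact; _⊗_; gaussCoeff)
  open PowerSeries
  open PolynomialCoefficients

  gauss : ℕ → ℕ → Series
  gauss zero    zero    = 𝟏
  gauss zero    (suc j) = 𝟎
  gauss (suc n) zero    = 𝟏
  gauss (suc n) (suc j) = gauss n (suc j) ⊞ shiftBy (n ∸ j) (gauss n j)

  gauss-n0 : ∀ n → gauss n 0 ≗ 𝟏
  gauss-n0 zero    k = refl
  gauss-n0 (suc n) k = refl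

  gauss-> : ∀ {n j} → n < j → gauss n j ≗ 𝟎
  gauss-> {zero}  {suc j} _         k = refl
  gauss-> {suc n} {suc j} (s≤s n<j) k =
    cong₂ _+_ (gauss-> (ℕ.m<n⇒m<1+n n<j) k)
              (trans (shiftBy-cong (n ∸ j) (gauss-> n<j) k) (shiftBy-𝟎 (n ∸ j) k))

  -- By induction along the q-Pascal rule, using [ n - j ]_q + q ^ (n - j) [ j + 1 ]_q = [ n + 1 ]_q.
  qfact-split : ∀ n j → j ≤ n → qfactˢ (n ∸ j) ⊠ qfactˢ j ⊠ gauss n j ≗ qfactˢ n
  qfact-split n       zero    _         = begin
    qfactˢ n ⊠ 𝟏 ⊠ gauss n 0  ≈⟨ ⊠-cong (⊠-identityʳ (qfactˢ n)) (gauss-n0 n) ⟩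
    qfactˢ n ⊠ 𝟏              ≈⟨ ⊠-identityʳ (qfactˢ n) ⟩
    qfactˢ n                  ∎
    where open SetoidReasoning (ℕ →-setoid ℤ)
  qfact-split (suc n) (suc j) (s≤s j≤n) = begin
    F a ⊠ F (suc j) ⊠ (gauss n (suc j) ⊞ shiftBy a (gauss n j))
      ≈⟨ ⊠-distribˡ-⊞ (F a ⊠ F (suc j)) _ _ ⟩
    F a ⊠ F (suc j) ⊠ gauss n (suc j) ⊞ F a ⊠ F (suc j) ⊠ shiftBy a (gauss n j)
      ≈⟨ ⊞-cong upper lower ⟩
    qintˢ a ⊠ F n ⊞ shiftBy a (qintˢ (suc j)) ⊠ F n
      ≈⟨ ⊠-distribʳ-⊞ (qintˢ a) _ (F n) ⟨
    (qintˢ a ⊞ shiftBy a (qintˢ (suc j))) ⊠ F n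
      ≈⟨ ⊠-congˡ (F n) (qintˢ-+ a (suc j)) ⟨
    qintˢ (a Data.Nat.+ suc j) ⊠ F n
      ≈⟨ ⊠-congˡ (F n) (λ k → cong (λ m → qintˢ m k) a+1+j≡1+n) ⟩
    qintˢ (suc n) ⊠ F n
      ≈⟨ ⊠-comm _ (F n) ⟩
    F n ⊠ qintˢ (suc n) ∎
    where
    open SetoidReasoning (ℕ →-setoid ℤ)
    F : ℕ → Series
    F = qfactˢ
    a : ℕ
    a = n ∸ j
    a+1+j≡1+n : a Data.Nat.+ suc j ≡ suc n
    a+1+j≡1+n = trans (ℕ.+-suc a j) (cong suc (ℕ.m∸n+n≡m j≤n))
    upper : F a ⊠ F (suc j) ⊠ gauss n (suc j) ≗ qintˢ a ⊠ F n
    upper with ℕ.m≤n⇒m<n∨m≡n j≤n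
    ... | inj₂ refl = begin
      F (n ∸ n) ⊠ F (suc n) ⊠ gauss n (suc n)  ≈⟨ ⊠-congʳ _ (gauss-> {n} ℕ.≤-refl) ⟩
      F (n ∸ n) ⊠ F (suc n) ⊠ 𝟎                ≈⟨ ⊠-zeroʳ _ ⟩
      𝟎                                        ≈⟨ ⊠-zeroˡ (F n) ⟨
      𝟎 ⊠ F n                                  ≈⟨ ⊠-congˡ (F n) (λ k → cong (λ m → qintˢ m k) (ℕ.n∸n≡0 n)) ⟨
      qintˢ (n ∸ n) ⊠ F n                      ∎
    ... | inj₁ j<n = begin
      F a ⊠ F (suc j) ⊠ gauss n (suc j)
        ≈⟨ ⊠-congˡ (gauss n (suc j)) (⊠-congˡ (F (suc j)) (λ k → cong (λ m → F m k) a≡1+a′)) ⟩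
      F a′ ⊠ qintˢ (suc a′) ⊠ F (suc j) ⊠ gauss n (suc j)
        ≈⟨ ⊠-congˡ (gauss n (suc j)) (⊠-swapʳ (F a′) _ _) ⟩
      F a′ ⊠ F (suc j) ⊠ qintˢ (suc a′) ⊠ gauss n (suc j)
        ≈⟨ ⊠-swapʳ (F a′ ⊠ F (suc j)) _ _ ⟩
      F a′ ⊠ F (suc j) ⊠ gauss n (suc j) ⊠ qintˢ (suc a′)
        ≈⟨ ⊠-cong (qfact-split n (suc j) j<n) (λ k → cong (λ m → qintˢ m k) (sym a≡1+a′)) ⟩
      F n ⊠ qintˢ a
        ≈⟨ ⊠-comm (F n) _ ⟩
      qintˢ a ⊠ F n ∎
      where
      a′ : ℕ
      a′ = n ∸ suc j
      a≡1+a′ : a ≡ suc a′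
      a≡1+a′ = ℕ.+-∸-assoc 1 j<n
    lower : F a ⊠ F (suc j) ⊠ shiftBy a (gauss n j) ≗ shiftBy a (qintˢ (suc j)) ⊠ F n
    lower = begin
      F a ⊠ (F j ⊠ qintˢ (suc j)) ⊠ shiftBy a (gauss n j)  ≈⟨ ⊠-shiftBy a _ _ ⟩
      shiftBy a (F a ⊠ (F j ⊠ qintˢ (suc j)) ⊠ gauss n j)
        ≈⟨ shiftBy-cong a (⊠-congˡ (gauss n j) (⊠-assoc (F a) (F j) _)) ⟨
      shiftBy a (F a ⊠ F j ⊠ qintˢ (suc j) ⊠ gauss n j)    ≈⟨ shiftBy-cong a (⊠-swapʳ (F a ⊠ F j) _ _) ⟩
      shiftBy a (F a ⊠ F j ⊠ gauss n j ⊠ qintˢ (suc j))    ≈⟨ shiftBy-cong a (⊠-congˡ _ (qfact-split n j j≤n)) ⟩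
      shiftBy a (F n ⊠ qintˢ (suc j))                       ≈⟨ shiftBy-cong a (⊠-comm (F n) _) ⟩
      shiftBy a (qintˢ (suc j) ⊠ F n)                       ≈⟨ shiftBy-⊠ a _ (F n) ⟨
      shiftBy a (qintˢ (suc j)) ⊠ F n                       ∎

  gaussCoeff≡gauss : ∀ {n j} → j ≤ n → ∀ k → gaussCoeff n j k ≡ gauss n j k
  gaussCoeff≡gauss {n} {j} j≤n =
    divCoeff-correct (qfact n) (qfact (n ∸ j) ⊗ qfact j) (gauss n j) denominator-constant qfact-divisible
    where
    denominator : Defs.coeff (qfact (n ∸ j) ⊗ qfact j) ≗ qfactˢ (n ∸ j) ⊠ qfactˢ j
    denominator k = trans (coeff-⊗ (qfact (n ∸ j)) (qfact j) k)
                          (⊠-cong (coeff-qfact (n ∸ j)) (coeff-qfact j) k)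
    denominator-constant : Defs.coeff (qfact (n ∸ j) ⊗ qfact j) 0 ≡ + 1
    denominator-constant = trans (denominator 0)
      (cong₂ _*_ (qfactˢ-constant (n ∸ j)) (qfactˢ-constant j))
    qfact-divisible : Defs.coeff (qfact n) ≗ Defs.coeff (qfact (n ∸ j) ⊗ qfact j) ⊠ gauss n j
    qfact-divisible k = trans (coeff-qfact n k)
      (sym (trans (⊠-congˡ (gauss n j) denominator k) (qfact-split n j j≤n k)))


module QBinomial where

  open import Data.Nat using (ℕ; zero; suc; _∸_; _≤_; _<_)
  import Data.Nat.Properties as ℕ
  open import Data.Integer using (ℤ; +_; _+_; _-_; _*_; -_)
  import Data.Integer.Properties as ℤ
  open import Relation.Binary.PropositionalEquality
  open import Defs using (sign)
  open PowerSeries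
  open GaussianPolynomials

  triangular : ℕ → ℕ
  triangular zero    = 0
  triangular (suc j) = suc j Data.Nat.+ triangular j

  oneMinusQ^ : ℕ → Series
  oneMinusQ^ m = 𝟏 ⊞ ⊟ shiftBy m 𝟏

  ⊠-oneMinusQ^ : ∀ m a → a ⊠ oneMinusQ^ m ≗ a ⊞ ⊟ shiftBy m a
  ⊠-oneMinusQ^ m a k = begin
    (a ⊠ oneMinusQ^ m) k                      ≡⟨ ⊠-distribˡ-⊞ a 𝟏 (⊟ shiftBy m 𝟏) k ⟩
    (a ⊠ 𝟏) k + (a ⊠ ⊟ shiftBy m 𝟏) k         ≡⟨ cong₂ _+_ (⊠-identityʳ a k) (⊠-⊟ a (shiftBy m 𝟏) k) ⟩
    a k - (a ⊠ shiftBy m 𝟏) k                 ≡⟨ cong (λ x → a k - x) (⊠-shiftBy m a 𝟏 k) ⟩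
    a k - shiftBy m (a ⊠ 𝟏) k                 ≡⟨ cong (λ x → a k - x) (shiftBy-cong m (⊠-identityʳ a) k) ⟩
    a k - shiftBy m a k                       ∎
    where open ≡-Reasoning

  qPochhammer : ℕ → Series
  qPochhammer zero    = 𝟏
  qPochhammer (suc n) = qPochhammer n ⊠ oneMinusQ^ (suc n)

  signedGauss : ℕ → ℕ → Series
  signedGauss n j = sign j · shiftBy (triangular j) (gauss n j)

  signedGauss-n0 : ∀ n → signedGauss n 0 ≗ 𝟏
  signedGauss-n0 n k = trans (ℤ.*-identityˡ (gauss n 0 k)) (gauss-n0 n k)

  signedGauss-> : ∀ n j → n < j → signedGauss n j ≗ 𝟎
  signedGauss-> n j n<j k = trans (cong (sign j *_) (trans (shiftBy-cong (triangular j) (gauss-> n<j) k)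
                                                           (shiftBy-𝟎 (triangular j) k)))
                                  (ℤ.*-zeroʳ (sign j))

  signedGauss-pascal : ∀ n j → j ≤ n →
    signedGauss (suc n) (suc j) ≗ signedGauss n (suc j) ⊞ ⊟ shiftBy (suc n) (signedGauss n j)
  signedGauss-pascal n j j≤n k = begin
    sign (suc j) * shiftBy (triangular (suc j)) (gauss n (suc j) ⊞ shiftBy (n ∸ j) (gauss n j)) k
      ≡⟨ cong (sign (suc j) *_) (shiftBy-⊞ (triangular (suc j)) (gauss n (suc j)) _ k) ⟩
    sign (suc j) * (shiftBy (triangular (suc j)) (gauss n (suc j)) k + lower)
      ≡⟨ ℤ.*-distribˡ-+ (sign (suc j)) _ lower ⟩
    signedGauss n (suc j) k + sign (suc j) * lower
      ≡⟨ cong (λ x → signedGauss n (suc j) k + x) lower-term ⟩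
    signedGauss n (suc j) k + - shiftBy (suc n) (signedGauss n j) k ∎
    where
    open ≡-Reasoning
    lower : ℤ
    lower = shiftBy (triangular (suc j)) (shiftBy (n ∸ j) (gauss n j)) k
    exponent : triangular (suc j) Data.Nat.+ (n ∸ j) ≡ suc n Data.Nat.+ triangular j
    exponent = begin
      suc j Data.Nat.+ triangular j Data.Nat.+ (n ∸ j)   ≡⟨ ℕ.+-assoc (suc j) (triangular j) (n ∸ j) ⟩
      suc j Data.Nat.+ (triangular j Data.Nat.+ (n ∸ j)) ≡⟨ cong (suc j Data.Nat.+_) (ℕ.+-comm (triangular j) (n ∸ j)) ⟩
      suc j Data.Nat.+ ((n ∸ j) Data.Nat.+ triangular j) ≡⟨ ℕ.+-assoc (suc j) (n ∸ j) (triangular j) ⟨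
      suc (j Data.Nat.+ (n ∸ j)) Data.Nat.+ triangular j ≡⟨ cong (λ m → suc m Data.Nat.+ triangular j) (ℕ.m+[n∸m]≡n j≤n) ⟩
      suc n Data.Nat.+ triangular j                      ∎
    lower-term : sign (suc j) * lower ≡ - shiftBy (suc n) (signedGauss n j) k
    lower-term = begin
      - sign j * lower
        ≡⟨ cong (- sign j *_) (trans (shiftBy-+ (triangular (suc j)) (n ∸ j) (gauss n j) k)
                                     (trans (cong (λ m → shiftBy m (gauss n j) k) exponent)
                                            (sym (shiftBy-+ (suc n) (triangular j) (gauss n j) k)))) ⟩
      - sign j * shiftBy (suc n) (shiftBy (triangular j) (gauss n j)) k
        ≡⟨ ℤ.neg-distribˡ-* (sign j) _ ⟨
      - (sign j * shiftBy (suc n) (shiftBy (triangular j) (gauss n j)) k)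
        ≡⟨ cong -_ (shiftBy-· (suc n) (sign j) (shiftBy (triangular j) (gauss n j)) k) ⟨
      - shiftBy (suc n) (signedGauss n j) k ∎

  -- The q-binomial theorem ∏ᵢ₌₀ⁿ⁻¹ (1 + x qⁱ) = ∑ⱼ q ^ (j (j - 1) / 2) [ n choose j ]_q xʲ at x = - q.
  qPochhammer≗∑signedGauss : ∀ n → qPochhammer n ≗ ∑ˢ (suc n) (signedGauss n)
  qPochhammer≗∑signedGauss zero    zero    = refl
  qPochhammer≗∑signedGauss zero    (suc k) = refl
  qPochhammer≗∑signedGauss (suc n) k = begin
    (qPochhammer n ⊠ oneMinusQ^ (suc n)) k
      ≡⟨ ⊠-congˡ (oneMinusQ^ (suc n)) (qPochhammer≗∑signedGauss n) k ⟩
    (Q ⊠ oneMinusQ^ (suc n)) k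
      ≡⟨ ⊠-oneMinusQ^ (suc n) Q k ⟩
    Q k + - shiftBy (suc n) Q k
      ≡⟨ cong₂ (λ x y → x + - y) Q-extended (shiftBy-∑ˢ (suc n) (suc n) (signedGauss n) k) ⟩
    signedGauss n 0 k + up + - (∑[ j < suc n ] shiftBy (suc n) (signedGauss n j) k)
      ≡⟨ cong (λ x → signedGauss n 0 k + up + x) (∑-neg (suc n) (λ j → shiftBy (suc n) (signedGauss n j) k)) ⟨
    signedGauss n 0 k + up + down
      ≡⟨ ℤ.+-assoc (signedGauss n 0 k) up down ⟩
    signedGauss n 0 k + (up + down)
      ≡⟨ cong₂ _+_ (trans (signedGauss-n0 n k) (sym (signedGauss-n0 (suc n) k)))
                   (sym (trans (∑-cong< (suc n) (λ j j≤n → signedGauss-pascal n j (ℕ.≤-pred j≤n) k))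
                               (∑-distrib-+ (suc n) (λ j → signedGauss n (suc j) k)
                                                            (λ j → - shiftBy (suc n) (signedGauss n j) k)))) ⟩
    ∑ˢ (suc (suc n)) (signedGauss (suc n)) k ∎
    where
    open ≡-Reasoning
    Q : Series
    Q = ∑ˢ (suc n) (signedGauss n)
    up : ℤ
    up = ∑[ j < suc n ] signedGauss n (suc j) k
    down : ℤ
    down = ∑[ j < suc n ] (- shiftBy (suc n) (signedGauss n j) k)
    Q-extended : Q k ≡ ∑ˢ (suc (suc n)) (signedGauss n) k
    Q-extended = sym (trans (∑-last (suc n) (λ j → signedGauss n j k))
                            (trans (cong (λ x → Q k + x) (signedGauss-> n (suc n) ℕ.≤-refl k)) (ℤ.+-identityʳ (Q k))))


module NegativeBinomial where

  open import Data.Nat using (ℕ; zero; suc)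
  import Data.Nat.Properties as ℕ
  open import Data.Nat.Combinatorics using (_C_; nCn≡1; nCk+nC[k+1]≡[n+1]C[k+1])
  open import Data.Integer using (ℤ; +_; _+_; _-_)
  import Data.Integer.Properties as ℤ
  open import Data.Integer.Tactic.RingSolver using (solve-∀)
  open import Relation.Binary.PropositionalEquality
  import Relation.Binary.Reasoning.Setoid as SetoidReasoning
  open PowerSeries
  open PolynomialCoefficients
  open QBinomial

  -- the coefficients of (1 - q) ^ (- n)
  negBinomial : ℕ → Series
  negBinomial zero      = 𝟏
  negBinomial (suc n) m = + ((n Data.Nat.+ m) C n)

  negBinomial-zero : ∀ n → negBinomial n 0 ≡ + 1
  negBinomial-zero zero    = refl
  negBinomial-zero (suc n) = cong +_ (trans (cong (_C n) (ℕ.+-identityʳ n)) (nCn≡1 n))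

  +[x+y]-y≡+x : ∀ x y → + (x Data.Nat.+ y) - + y ≡ + x
  +[x+y]-y≡+x x y = trans (cong (_- + y) (ℤ.pos-+ x y)) (cancel (+ x) (+ y))
    where
    cancel : ∀ a b → a + b - b ≡ a
    cancel = solve-∀

  negBinomial-⊠-oneMinusQ : ∀ n → negBinomial (suc n) ⊠ oneMinusQ^ 1 ≗ negBinomial n
  negBinomial-⊠-oneMinusQ n k = trans (⊠-oneMinusQ^ 1 (negBinomial (suc n)) k) (difference n k)
    where
    difference : ∀ n k → negBinomial (suc n) k - shift (negBinomial (suc n)) k ≡ negBinomial n k
    difference n       zero    = trans (ℤ.+-identityʳ (negBinomial (suc n) 0))
                                       (trans (negBinomial-zero (suc n)) (sym (negBinomial-zero n)))
    difference zero    (suc k) = refl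
    difference (suc n) (suc k) = begin
      + (suc X C suc n) - + ((suc n Data.Nat.+ k) C suc n)
        ≡⟨ cong₂ (λ a b → + a - + (b C suc n)) (nCk+nC[k+1]≡[n+1]C[k+1] X n) (ℕ.+-suc n k) ⟨
      + (X C n Data.Nat.+ X C suc n) - + (X C suc n)
        ≡⟨ +[x+y]-y≡+x (X C n) (X C suc n) ⟩
      + (X C n) ∎
      where
      open ≡-Reasoning
      X : ℕ
      X = n Data.Nat.+ suc k

  qintˢ-⊠-oneMinusQ : ∀ m → qintˢ m ⊠ oneMinusQ^ 1 ≗ oneMinusQ^ m
  qintˢ-⊠-oneMinusQ m k = trans (⊠-oneMinusQ^ 1 (qintˢ m) k) (telescope m k)
    where
    telescope : ∀ m k → qintˢ m k - shift (qintˢ m) k ≡ oneMinusQ^ m k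
    telescope zero          zero          = refl
    telescope zero          (suc k)       = refl
    telescope (suc m)       zero          = refl
    telescope (suc zero)    (suc zero)    = refl
    telescope (suc (suc m)) (suc zero)    = refl
    telescope (suc m)       (suc (suc k)) = telescope m (suc k)

  qfact≗qPochhammer⊠negBinomial : ∀ n → qfactˢ n ≗ qPochhammer n ⊠ negBinomial n
  qfact≗qPochhammer⊠negBinomial zero    = λ k → sym (⊠-identityʳ 𝟏 k)
  qfact≗qPochhammer⊠negBinomial (suc n) = begin
    qfactˢ n ⊠ [1+n]                           ≈⟨ ⊠-congˡ [1+n] (qfact≗qPochhammer⊠negBinomial n) ⟩
    P n ⊠ E n ⊠ [1+n]                          ≈⟨ ⊠-swapʳ (P n) (E n) [1+n] ⟩
    P n ⊠ [1+n] ⊠ E n                          ≈⟨ ⊠-congʳ (P n ⊠ [1+n]) (negBinomial-⊠-oneMinusQ n) ⟨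
    P n ⊠ [1+n] ⊠ (E (suc n) ⊠ oneMinusQ^ 1)   ≈⟨ ⊠-congʳ (P n ⊠ [1+n]) (⊠-comm (E (suc n)) _) ⟩
    P n ⊠ [1+n] ⊠ (oneMinusQ^ 1 ⊠ E (suc n))   ≈⟨ ⊠-assoc (P n ⊠ [1+n]) _ (E (suc n)) ⟨
    P n ⊠ [1+n] ⊠ oneMinusQ^ 1 ⊠ E (suc n)     ≈⟨ ⊠-congˡ (E (suc n)) (⊠-assoc (P n) [1+n] _) ⟩
    P n ⊠ ([1+n] ⊠ oneMinusQ^ 1) ⊠ E (suc n)   ≈⟨ ⊠-congˡ (E (suc n)) (⊠-congʳ (P n) (qintˢ-⊠-oneMinusQ (suc n))) ⟩
    P (suc n) ⊠ E (suc n)                      ∎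
    where
    open SetoidReasoning (ℕ →-setoid ℤ)
    P : ℕ → Series
    P = qPochhammer
    E : ℕ → Series
    E = negBinomial
    [1+n] : Series
    [1+n] = qintˢ (suc n)


module InversionCounting where

  open import Data.Nat using (ℕ; zero; suc; _+_; _*_; _∸_; _≤_; _<_; z≤n; s≤s; _≤?_; _<?_; _≟_)
  import Data.Nat.Properties as ℕ
  open import Data.Fin as Fin using (Fin; toℕ; punchIn)
  import Data.Fin.Properties as Fin
  open import Data.List using (List; []; _∷_; map; length; filter; concatMap; allFin; tabulate; _++_)
  import Data.List.Properties as List
  open import Data.List.Relation.Unary.All as All using (All; []; _∷_)
  import Data.List.Relation.Unary.All.Properties as All
  open import Data.List.Relation.Unary.AllPairs using ([]; _∷_)
  open import Data.List.Relation.Unary.Unique.Propositional using (Unique)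
  import Data.List.Relation.Unary.Unique.Propositional.Properties as Unique
  open import Data.Product using (_,_)
  open import Relation.Unary using (Decidable)
  open import Data.Empty using (⊥-elim)
  open import Function using (_∘_; id)
  open import Relation.Nullary using (Dec; yes; no; ¬_; ¬?; _×-dec_)
  open import Relation.Binary.PropositionalEquality
  open import Defs using (allSeqs; inversions; I; module U)
  open import Level using (Level)

  private
    variable
      a b p q : Level
      A : Set a
      B : Set b
      P : Set p
      Q : Set q

  iverson : Dec P → ℕ
  iverson (yes _) = 1
  iverson (no _)  = 0

  iverson-cong : (P → Q) → (Q → P) → (d : Dec P) (e : Dec Q) → iverson d ≡ iverson e
  iverson-cong f g (yes x) (yes y) = refl
  iverson-cong f g (yes x) (no ¬y) = ⊥-elim (¬y (f x))
  iverson-cong f g (no ¬x) (yes y) = ⊥-elim (¬x (g y))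
  iverson-cong f g (no ¬x) (no ¬y) = refl

  iverson-× : (d : Dec P) (e : Dec Q) → iverson (d ×-dec e) ≡ iverson d * iverson e
  iverson-× (yes _) (yes _) = refl
  iverson-× (yes _) (no _)  = refl
  iverson-× (no _)  (yes _) = refl
  iverson-× (no _)  (no _)  = refl

  iverson-yes : P → (d : Dec P) → iverson d ≡ 1
  iverson-yes x (yes _) = refl
  iverson-yes x (no ¬x) = ⊥-elim (¬x x)

  iverson-no : ¬ P → (d : Dec P) → iverson d ≡ 0
  iverson-no ¬x (yes x) = ⊥-elim (¬x x)
  iverson-no ¬x (no _)  = refl

  sumOver : (A → ℕ) → List A → ℕ
  sumOver φ []       = 0
  sumOver φ (x ∷ xs) = φ x + sumOver φ xs

  sumOver-cong : ∀ {φ ψ : A → ℕ} (xs : List A) → (∀ x → φ x ≡ ψ x) → sumOver φ xs ≡ sumOver ψ xs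
  sumOver-cong []       e = refl
  sumOver-cong (x ∷ xs) e = cong₂ _+_ (e x) (sumOver-cong xs e)

  length-filter : ∀ {P : A → Set p} (P? : Decidable P) xs →
                  length (filter P? xs) ≡ sumOver (iverson ∘ P?) xs
  length-filter P? []       = refl
  length-filter P? (x ∷ xs) with P? x
  ... | yes _ = cong suc (length-filter P? xs)
  ... | no _  = length-filter P? xs

  sumOver-filter : ∀ {P : A → Set p} (P? : Decidable P) (φ : A → ℕ) xs →
                   sumOver φ (filter P? xs) ≡ sumOver (λ x → iverson (P? x) * φ x) xs
  sumOver-filter P? φ []       = refl
  sumOver-filter P? φ (x ∷ xs) with P? x
  ... | yes _ = cong₂ _+_ (sym (ℕ.+-identityʳ (φ x))) (sumOver-filter P? φ xs)
  ... | no _  = sumOver-filter P? φ xs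

  sumOver-++ : ∀ (φ : A → ℕ) (xs ys : List A) → sumOver φ (xs ++ ys) ≡ sumOver φ xs + sumOver φ ys
  sumOver-++ φ []       ys = refl
  sumOver-++ φ (x ∷ xs) ys = trans (cong (φ x +_) (sumOver-++ φ xs ys)) (sym (ℕ.+-assoc (φ x) _ _))

  *-distribˡ-sumOver : ∀ c (φ : A → ℕ) (xs : List A) → sumOver (λ x → c * φ x) xs ≡ c * sumOver φ xs
  *-distribˡ-sumOver c φ []       = sym (ℕ.*-zeroʳ c)
  *-distribˡ-sumOver c φ (x ∷ xs) = trans (cong (c * φ x +_) (*-distribˡ-sumOver c φ xs))
                                        (sym (ℕ.*-distribˡ-+ c (φ x) _))

  sumOver-map : ∀ (φ : B → ℕ) (f : A → B) xs → sumOver φ (map f xs) ≡ sumOver (φ ∘ f) xs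
  sumOver-map φ f []       = refl
  sumOver-map φ f (x ∷ xs) = cong (φ (f x) +_) (sumOver-map φ f xs)

  sumOver-concatMap : ∀ (φ : B → ℕ) (f : A → List B) xs →
                      sumOver φ (concatMap f xs) ≡ sumOver (sumOver φ ∘ f) xs
  sumOver-concatMap φ f []       = refl
  sumOver-concatMap φ f (x ∷ xs) = trans (sumOver-++ φ (f x) (concatMap f xs))
                                         (cong (sumOver φ (f x) +_) (sumOver-concatMap φ f xs))

  ∑Fin : ∀ {N} → (Fin N → ℕ) → ℕ
  ∑Fin {zero}  g = 0
  ∑Fin {suc N} g = g Fin.zero + ∑Fin (g ∘ Fin.suc)

  ∑Fin-cong : ∀ {N} {g h : Fin N → ℕ} → (∀ x → g x ≡ h x) → ∑Fin g ≡ ∑Fin h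
  ∑Fin-cong {zero}  e = refl
  ∑Fin-cong {suc N} e = cong₂ _+_ (e Fin.zero) (∑Fin-cong (e ∘ Fin.suc))

  sumOver-tabulate : ∀ {N} (φ : A → ℕ) (f : Fin N → A) → sumOver φ (tabulate f) ≡ ∑Fin (φ ∘ f)
  sumOver-tabulate {N = zero}  φ f = refl
  sumOver-tabulate {N = suc N} φ f = cong (φ (f Fin.zero) +_) (sumOver-tabulate φ (f ∘ Fin.suc))

  ∑Fin-punchIn : ∀ {N} (x : Fin (suc N)) (h : Fin (suc N) → ℕ) →
                 ∑Fin (λ y → iverson (¬? (x Fin.≟ y)) * h y) ≡ ∑Fin (h ∘ punchIn x)
  ∑Fin-punchIn {N} Fin.zero h = cong₂ _+_
    (cong (_* h Fin.zero) (iverson-no (λ ¬eq → ¬eq refl) (¬? (Fin.zero {N} Fin.≟ Fin.zero))))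
    (∑Fin-cong (λ y → trans (cong (_* h (Fin.suc y)) (iverson-yes (λ ()) (¬? (Fin.zero Fin.≟ Fin.suc y))))
                            (ℕ.*-identityˡ _)))
  ∑Fin-punchIn {suc N} (Fin.suc x) h = cong₂ _+_
    (trans (cong (_* h Fin.zero) (iverson-yes (λ ()) (¬? (Fin.suc x Fin.≟ Fin.zero)))) (ℕ.*-identityˡ _))
    (trans (∑Fin-cong (λ y → cong (_* h (Fin.suc y))
                        (iverson-cong (λ ne eq → ne (cong Fin.suc eq)) (λ ne eq → ne (Fin.suc-injective eq))
                                      (¬? (Fin.suc x Fin.≟ Fin.suc y)) (¬? (x Fin.≟ y)))))
           (∑Fin-punchIn x (h ∘ Fin.suc)))

  sumOver-allSeqs-suc : ∀ m N (φ : List (Fin N) → ℕ) →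
                        sumOver φ (allSeqs (suc m) N) ≡ ∑Fin (λ x → sumOver (φ ∘ (x ∷_)) (allSeqs m N))
  sumOver-allSeqs-suc m N φ = begin
    sumOver φ (concatMap (λ x → map (x ∷_) (allSeqs m N)) (allFin N))
      ≡⟨ sumOver-concatMap φ (λ x → map (x ∷_) (allSeqs m N)) (allFin N) ⟩
    sumOver (λ x → sumOver φ (map (x ∷_) (allSeqs m N))) (allFin N)
      ≡⟨ sumOver-tabulate (λ x → sumOver φ (map (x ∷_) (allSeqs m N))) id ⟩
    ∑Fin (λ x → sumOver φ (map (x ∷_) (allSeqs m N)))
      ≡⟨ ∑Fin-cong (λ x → sumOver-map φ (x ∷_) (allSeqs m N)) ⟩
    ∑Fin (λ x → sumOver (φ ∘ (x ∷_)) (allSeqs m N)) ∎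
    where open ≡-Reasoning

  sumOver-allSeqs-cong : ∀ m N (φ ψ : List (Fin N) → ℕ) → (∀ s → length s ≡ m → φ s ≡ ψ s) →
                         sumOver φ (allSeqs m N) ≡ sumOver ψ (allSeqs m N)
  sumOver-allSeqs-cong zero    N φ ψ e = cong (_+ 0) (e [] refl)
  sumOver-allSeqs-cong (suc m) N φ ψ e = begin
    sumOver φ (allSeqs (suc m) N)                    ≡⟨ sumOver-allSeqs-suc m N φ ⟩
    ∑Fin (λ x → sumOver (φ ∘ (x ∷_)) (allSeqs m N))
      ≡⟨ ∑Fin-cong (λ x → sumOver-allSeqs-cong m N _ _ (λ s p → e (x ∷ s) (cong suc p))) ⟩
    ∑Fin (λ x → sumOver (ψ ∘ (x ∷_)) (allSeqs m N))  ≡⟨ sumOver-allSeqs-suc m N ψ ⟨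
    sumOver ψ (allSeqs (suc m) N)                    ∎
    where open ≡-Reasoning

  length-filter-partition : ∀ {P : A → Set p} (P? : Decidable P) xs →
                            length (filter P? xs) + length (filter (¬? ∘ P?) xs) ≡ length xs
  length-filter-partition P? []       = refl
  length-filter-partition P? (x ∷ xs) with P? x
  ... | yes _ = cong suc (length-filter-partition P? xs)
  ... | no _  = trans (ℕ.+-suc _ _) (cong suc (length-filter-partition P? xs))

  length≤1+length-remove : ∀ c xs → Unique xs → length xs ≤ suc (length (filter (λ z → ¬? (z ≟ c)) xs))
  length≤1+length-remove c []       _          = z≤n
  length≤1+length-remove c (x ∷ xs) (x∉xs ∷ u) with x ≟ c
  ... | yes refl = s≤s (ℕ.≤-reflexive (cong length (sym (begin
    filter ≢x? (x ∷ xs)  ≡⟨ List.filter-reject ≢x? (λ x≢x → x≢x refl) ⟩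
    filter ≢x? xs        ≡⟨ List.filter-all ≢x? (All.map (λ x≢z z≡x → x≢z (sym z≡x)) x∉xs) ⟩
    xs                   ∎))))
    where
    open ≡-Reasoning
    ≢x? : Decidable (λ z → z ≢ x)
    ≢x? = λ z → ¬? (z ≟ x)
  ... | no x≢c = subst (suc (length xs) ≤_) (cong (suc ∘ length) (sym (List.filter-accept (λ z → ¬? (z ≟ c)) x≢c)))
                       (s≤s (length≤1+length-remove c xs u))

  length-unique-bounded : ∀ h xs → Unique xs → All (_< h) xs → length xs ≤ h
  length-unique-bounded zero    []       _ _         = z≤n
  length-unique-bounded zero    (x ∷ xs) _ (() ∷ _)
  length-unique-bounded (suc h) xs       u xs<1+h    = ℕ.≤-trans (length≤1+length-remove h xs u)
    (s≤s (length-unique-bounded h (filter ≢h? xs) (Unique.filter⁺ ≢h? u)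
           (All.zipWith (λ (x<1+h , x≢h) → ℕ.≤∧≢⇒< (ℕ.≤-pred x<1+h) x≢h)
                        (All.filter⁺ ≢h? xs<1+h , All.all-filter ≢h? xs))))
    where
    ≢h? : Decidable (λ z → z ≢ h)
    ≢h? = λ z → ¬? (z ≟ h)

  unique-map-∸ : ∀ c xs → Unique xs → All (c ≤_) xs → Unique (map (_∸ c) xs)
  unique-map-∸ c []       []           []            = []
  unique-map-∸ c (x ∷ xs) (x∉xs ∷ u) (c≤x ∷ c≤xs) =
    All.map⁺ (All.zipWith (λ (x≢y , c≤y) eq → x≢y (ℕ.∸-cancelʳ-≡ c≤x c≤y eq)) (x∉xs , c≤xs))
    ∷ unique-map-∸ c xs u c≤xs

  count-below : ∀ n c xs → Unique xs → All (_< n) xs → length xs ≡ n → c ≤ n →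
                length (filter (_<? c) xs) ≡ c
  count-below n c xs u xs<n len c≤n = ℕ.≤-antisym below≤c c≤below
    where
    open ℕ.≤-Reasoning
    below : List ℕ
    below = filter (_<? c) xs
    above : List ℕ
    above = filter (¬? ∘ (_<? c)) xs
    c≤above : All (c ≤_) above
    c≤above = All.map ℕ.≮⇒≥ (All.all-filter (¬? ∘ (_<? c)) xs)
    below≤c : length below ≤ c
    below≤c = length-unique-bounded c below (Unique.filter⁺ (_<? c) u) (All.all-filter (_<? c) xs)
    above≤n∸c : length above ≤ n ∸ c
    above≤n∸c = subst (_≤ n ∸ c) (List.length-map (_∸ c) above)
      (length-unique-bounded (n ∸ c) (map (_∸ c) above)
        (unique-map-∸ c above (Unique.filter⁺ (¬? ∘ (_<? c)) u) c≤above)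
        (All.map⁺ (All.zipWith (λ (x<n , c≤x) → ℕ.∸-monoˡ-< x<n c≤x)
                               (All.filter⁺ (¬? ∘ (_<? c)) xs<n , c≤above))))
    c≤below : c ≤ length below
    c≤below = ℕ.+-cancelʳ-≤ (n ∸ c) c (length below) (begin
      c + (n ∸ c)                   ≡⟨ ℕ.m+[n∸m]≡n c≤n ⟩
      n                             ≡⟨ trans (length-filter-partition (_<? c) xs) len ⟨
      length below + length above   ≤⟨ ℕ.+-monoʳ-≤ (length below) above≤n∸c ⟩
      length below + (n ∸ c)        ∎)

  Avoids : ∀ {N} → Fin N → List (Fin N) → Set
  Avoids x = All (x ≢_)

  avoids? : ∀ {N} (x : Fin N) s → Dec (Avoids x s)
  avoids? x = All.all? (λ y → ¬? (x Fin.≟ y))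

  unique? : ∀ {N} (s : List (Fin N)) → Dec (Unique s)
  unique? {N} = U.unique? {N}

  iverson-unique-∷ : ∀ {N} (x : Fin N) s → iverson (unique? (x ∷ s)) ≡ iverson (avoids? x s) * iverson (unique? s)
  iverson-unique-∷ x s = trans (iverson-cong (λ { (x∉s ∷ u) → x∉s , u }) (λ { (x∉s , u) → x∉s ∷ u })
                                             (unique? (x ∷ s)) (avoids? x s ×-dec unique? s))
                               (iverson-× (avoids? x s) (unique? s))

  iverson-avoids-∷ : ∀ {N} (x y : Fin N) s →
                     iverson (avoids? x (y ∷ s)) ≡ iverson (¬? (x Fin.≟ y)) * iverson (avoids? x s)
  iverson-avoids-∷ x y s = trans (iverson-cong (λ { (x≢y ∷ a) → x≢y , a }) (λ { (x≢y , a) → x≢y ∷ a })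
                                               (avoids? x (y ∷ s)) (¬? (x Fin.≟ y) ×-dec avoids? x s))
                                 (iverson-× (¬? (x Fin.≟ y)) (avoids? x s))

  -- The sequences over Fin (suc N) avoiding x are exactly the images of sequences over Fin N under punchIn x.
  sumOver-avoiding : ∀ m {N} (x : Fin (suc N)) (ψ : List (Fin (suc N)) → ℕ) →
    sumOver (λ s → iverson (avoids? x s) * ψ s) (allSeqs m (suc N)) ≡ sumOver (ψ ∘ map (punchIn x)) (allSeqs m N)
  sumOver-avoiding zero    x ψ = cong (_+ 0) (ℕ.*-identityˡ (ψ []))
  sumOver-avoiding (suc m) {N} x ψ = begin
    sumOver (λ s → iverson (avoids? x s) * ψ s) (allSeqs (suc m) (suc N))
      ≡⟨ sumOver-allSeqs-suc m (suc N) _ ⟩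
    ∑Fin (λ y → sumOver (λ s → iverson (avoids? x (y ∷ s)) * ψ (y ∷ s)) (allSeqs m (suc N)))
      ≡⟨ ∑Fin-cong head ⟩
    ∑Fin (λ y → iverson (¬? (x Fin.≟ y)) * sumOver (λ s → ψ (y ∷ map (punchIn x) s)) (allSeqs m N))
      ≡⟨ ∑Fin-punchIn x (λ y → sumOver (λ s → ψ (y ∷ map (punchIn x) s)) (allSeqs m N)) ⟩
    ∑Fin (λ y → sumOver (λ s → ψ (punchIn x y ∷ map (punchIn x) s)) (allSeqs m N))
      ≡⟨ sumOver-allSeqs-suc m N _ ⟨
    sumOver (ψ ∘ map (punchIn x)) (allSeqs (suc m) N) ∎
    where
    open ≡-Reasoning
    head : ∀ y → sumOver (λ s → iverson (avoids? x (y ∷ s)) * ψ (y ∷ s)) (allSeqs m (suc N))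
               ≡ iverson (¬? (x Fin.≟ y)) * sumOver (λ s → ψ (y ∷ map (punchIn x) s)) (allSeqs m N)
    head y = begin
      sumOver (λ s → iverson (avoids? x (y ∷ s)) * ψ (y ∷ s)) (allSeqs m (suc N))
        ≡⟨ sumOver-cong (allSeqs m (suc N)) (λ s → trans (cong (_* ψ (y ∷ s)) (iverson-avoids-∷ x y s))
                                                         (ℕ.*-assoc (iverson (¬? (x Fin.≟ y))) _ _)) ⟩
      sumOver (λ s → iverson (¬? (x Fin.≟ y)) * (iverson (avoids? x s) * ψ (y ∷ s))) (allSeqs m (suc N))
        ≡⟨ *-distribˡ-sumOver (iverson (¬? (x Fin.≟ y))) _ (allSeqs m (suc N)) ⟩
      iverson (¬? (x Fin.≟ y)) * sumOver (λ s → iverson (avoids? x s) * ψ (y ∷ s)) (allSeqs m (suc N))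
        ≡⟨ cong (iverson (¬? (x Fin.≟ y)) *_) (sumOver-avoiding m x (ψ ∘ (y ∷_))) ⟩
      iverson (¬? (x Fin.≟ y)) * sumOver (λ s → ψ (y ∷ map (punchIn x) s)) (allSeqs m N) ∎

  length-filter-map : ∀ {P : B → Set p} {Q : A → Set q} (P? : Decidable P) (Q? : Decidable Q) (f : A → B) →
    (∀ y → P (f y) → Q y) → (∀ y → Q y → P (f y)) → ∀ s → length (filter P? (map f s)) ≡ length (filter Q? s)
  length-filter-map P? Q? f to from s = begin
    length (filter P? (map f s))        ≡⟨ length-filter P? (map f s) ⟩
    sumOver (iverson ∘ P?) (map f s)    ≡⟨ sumOver-map (iverson ∘ P?) f s ⟩
    sumOver (iverson ∘ P? ∘ f) s        ≡⟨ sumOver-cong s (λ y → iverson-cong (to y) (from y) (P? (f y)) (Q? y)) ⟩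
    sumOver (iverson ∘ Q?) s            ≡⟨ length-filter Q? s ⟨
    length (filter Q? s)                ∎
    where open ≡-Reasoning

  iverson-unique-map : ∀ {n m} (f : Fin n → Fin m) → (∀ {a b} → f a ≡ f b → a ≡ b) → ∀ s →
                       iverson (unique? (map f s)) ≡ iverson (unique? s)
  iverson-unique-map f f-injective s =
    iverson-cong Unique.map⁻ (Unique.map⁺ f-injective) (unique? (map f s)) (unique? s)

  punchIn-<-cancel : ∀ {n} (x : Fin (suc n)) (z y : Fin n) → toℕ (punchIn x z) < toℕ (punchIn x y) → toℕ z < toℕ y
  punchIn-<-cancel x z y lt = ℕ.≰⇒> (λ y≤z → ℕ.<⇒≱ lt (Fin.punchIn-mono-≤ x y z y≤z))

  punchIn-<-mono : ∀ {n} (x : Fin (suc n)) (z y : Fin n) → toℕ z < toℕ y → toℕ (punchIn x z) < toℕ (punchIn x y)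
  punchIn-<-mono x z y z<y = ℕ.≰⇒> (λ le → ℕ.<⇒≱ z<y (Fin.punchIn-cancel-≤ x y z le))

  inversions-map-punchIn : ∀ {n} (x : Fin (suc n)) s → inversions (map (punchIn x) s) ≡ inversions s
  inversions-map-punchIn x []      = refl
  inversions-map-punchIn x (y ∷ s) = cong₂ _+_
    (length-filter-map (λ z → toℕ z <? toℕ (punchIn x y)) (λ z → toℕ z <? toℕ y) (punchIn x)
                       (λ z → punchIn-<-cancel x z y) (λ z → punchIn-<-mono x z y) s)
    (inversions-map-punchIn x s)

  punchIn-<-pivot : ∀ {n} (x : Fin (suc n)) (y : Fin n) → toℕ (punchIn x y) < toℕ x → toℕ y < toℕ x
  punchIn-<-pivot Fin.zero    y           ()
  punchIn-<-pivot (Fin.suc x) Fin.zero    _         = s≤s z≤n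
  punchIn-<-pivot (Fin.suc x) (Fin.suc y) (s≤s lt) = s≤s (punchIn-<-pivot x y lt)

  <-pivot-punchIn : ∀ {n} (x : Fin (suc n)) (y : Fin n) → toℕ y < toℕ x → toℕ (punchIn x y) < toℕ x
  <-pivot-punchIn Fin.zero    y           ()
  <-pivot-punchIn (Fin.suc x) Fin.zero    _         = s≤s z≤n
  <-pivot-punchIn (Fin.suc x) (Fin.suc y) (s≤s lt) = s≤s (<-pivot-punchIn x y lt)

  count-below-punchIn : ∀ {n} (s : List (Fin n)) → Unique s → length s ≡ n → (x : Fin (suc n)) →
                        length (filter (λ y → toℕ y <? toℕ x) (map (punchIn x) s)) ≡ toℕ x
  count-below-punchIn {n} s u len x = begin
    length (filter (λ y → toℕ y <? toℕ x) (map (punchIn x) s))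
      ≡⟨ length-filter-map (λ y → toℕ y <? toℕ x) below? (punchIn x) (punchIn-<-pivot x) (<-pivot-punchIn x) s ⟩
    length (filter below? s)
      ≡⟨ length-filter-map (_<? toℕ x) below? toℕ (λ _ lt → lt) (λ _ lt → lt) s ⟨
    length (filter (_<? toℕ x) (map toℕ s))
      ≡⟨ count-below n (toℕ x) (map toℕ s) (Unique.map⁺ Fin.toℕ-injective u)
                     (All.map⁺ (All.tabulate (λ {y} _ → Fin.toℕ<n y)))
                     (trans (List.length-map toℕ s) len) (ℕ.≤-pred (Fin.toℕ<n x)) ⟩
    toℕ x ∎
    where
    open ≡-Reasoning
    below? : Decidable (λ (y : Fin n) → toℕ y < toℕ x)
    below? = λ (y : Fin n) → toℕ y <? toℕ x

  iverson-+≟ : ∀ a v t → iverson (a + v ≟ t) ≡ iverson (a ≤? t) * iverson (v ≟ t ∸ a)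
  iverson-+≟ a v t with a ≤? t
  ... | yes a≤t = trans (iverson-cong (λ eq → trans (sym (ℕ.m+n∸m≡n a v)) (cong (_∸ a) eq))
                                      (λ eq → trans (cong (a +_) eq) (ℕ.m+[n∸m]≡n a≤t))
                                      (a + v ≟ t) (v ≟ t ∸ a))
                        (sym (ℕ.+-identityʳ _))
  ... | no a≰t  = iverson-no (λ eq → a≰t (subst (a ≤_) eq (ℕ.m≤m+n a v))) (a + v ≟ t)

  weight-punchIn : ∀ {n} t (x : Fin (suc n)) s → length s ≡ n →
    iverson (unique? (map (punchIn x) s)) * iverson (inversions (x ∷ map (punchIn x) s) ≟ t)
      ≡ iverson (toℕ x ≤? t) * (iverson (unique? s) * iverson (inversions s ≟ t ∸ toℕ x))
  weight-punchIn t x s len with unique? s in eq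
  ... | yes u = begin
    iverson (unique? (map (punchIn x) s)) * iverson (inversions (x ∷ map (punchIn x) s) ≟ t)
      ≡⟨ cong₂ _*_ (trans (iverson-unique-map (punchIn x) (Fin.punchIn-injective x _ _) s) (cong iverson eq))
                   (cong (λ v → iverson (v ≟ t)) (cong₂ _+_ (count-below-punchIn s u len x) (inversions-map-punchIn x s))) ⟩
    1 * iverson (toℕ x + inversions s ≟ t)
      ≡⟨ trans (ℕ.*-identityˡ _) (iverson-+≟ (toℕ x) (inversions s) t) ⟩
    iverson (toℕ x ≤? t) * iverson (inversions s ≟ t ∸ toℕ x)
      ≡⟨ cong (iverson (toℕ x ≤? t) *_) (ℕ.*-identityˡ _) ⟨
    iverson (toℕ x ≤? t) * (1 * iverson (inversions s ≟ t ∸ toℕ x)) ∎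
    where open ≡-Reasoning
  ... | no _ = trans (cong (_* iverson (inversions (x ∷ map (punchIn x) s) ≟ t))
                           (trans (iverson-unique-map (punchIn x) (Fin.punchIn-injective x _ _) s) (cong iverson eq)))
                     (sym (ℕ.*-zeroʳ (iverson (toℕ x ≤? t))))

  permCount : ℕ → ℕ → ℕ
  permCount n t = sumOver (λ p → iverson (unique? p) * iverson (inversions p ≟ t)) (allSeqs n n)

  I≡permCount : ∀ n t → I n t ≡ permCount n t
  I≡permCount n t = trans (length-filter (λ p → inversions p ≟ t) (filter (unique? {n}) (allSeqs n n)))
                          (sumOver-filter unique? _ (allSeqs n n))

  permCount-suc : ∀ n t → permCount (suc n) t ≡ ∑Fin {suc n} (λ x → iverson (toℕ x ≤? t) * permCount n (t ∸ toℕ x))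
  permCount-suc n t = trans (sumOver-allSeqs-suc n (suc n) _) (∑Fin-cong λ x → begin
    sumOver (λ s → iverson (unique? (x ∷ s)) * iverson (inversions (x ∷ s) ≟ t)) (allSeqs n (suc n))
      ≡⟨ sumOver-cong (allSeqs n (suc n)) (λ s → trans (cong (_* iverson (inversions (x ∷ s) ≟ t)) (iverson-unique-∷ x s))
                                                      (ℕ.*-assoc (iverson (avoids? x s)) _ _)) ⟩
    sumOver (λ s → iverson (avoids? x s) * rest x s) (allSeqs n (suc n))
      ≡⟨ sumOver-avoiding n x (rest x) ⟩
    sumOver (rest x ∘ map (punchIn x)) (allSeqs n n)
      ≡⟨ sumOver-allSeqs-cong n n _ _ (weight-punchIn t x) ⟩
    sumOver (λ s → iverson (toℕ x ≤? t) * (iverson (unique? s) * iverson (inversions s ≟ t ∸ toℕ x))) (allSeqs n n)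
      ≡⟨ *-distribˡ-sumOver (iverson (toℕ x ≤? t)) _ (allSeqs n n) ⟩
    iverson (toℕ x ≤? t) * permCount n (t ∸ toℕ x) ∎)
    where
    open ≡-Reasoning
    rest : Fin (suc n) → List (Fin (suc n)) → ℕ
    rest x s = iverson (unique? s) * iverson (inversions (x ∷ s) ≟ t)

module InversionGeneratingFunction where

  open import Data.Nat using (ℕ; zero; suc; _∸_; _≤?_; z≤n; s≤s)
  import Data.Nat.Properties as ℕ
  open import Data.Integer using (+_; _+_; _*_)
  import Data.Integer.Properties as ℤ
  open import Data.Fin using (toℕ)
  open import Function using (_∘_)
  open import Relation.Binary.PropositionalEquality
  open import Defs using (I)
  open PowerSeries
  open PolynomialCoefficients
  open QBinomial
  open NegativeBinomial
  open InversionCounting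

  +∑Fin≡∑< : ∀ m (φ : ℕ → ℕ) → + ∑Fin {m} (φ ∘ toℕ) ≡ ∑[ i < m ] + φ i
  +∑Fin≡∑< zero    φ = refl
  +∑Fin≡∑< (suc m) φ = trans (ℤ.pos-+ (φ 0) (∑Fin {m} (φ ∘ suc ∘ toℕ)))
                             (cong (λ x → + φ 0 + x) (+∑Fin≡∑< m (φ ∘ suc)))

  +iverson-≤≡qintˢ : ∀ i t → + iverson (i ≤? t) ≡ qintˢ (suc t) i
  +iverson-≤≡qintˢ zero    t       = cong +_ (iverson-yes z≤n (zero ≤? t))
  +iverson-≤≡qintˢ (suc i) zero    = cong +_ (iverson-no (λ ()) (suc i ≤? zero))
  +iverson-≤≡qintˢ (suc i) (suc t) = trans (cong +_ (iverson-cong ℕ.≤-pred s≤s (suc i ≤? suc t) (i ≤? t)))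
                                           (+iverson-≤≡qintˢ i t)

  permCount≡qfact : ∀ n t → + permCount n t ≡ qfactˢ n t
  permCount≡qfact zero    zero    = refl
  permCount≡qfact zero    (suc t) = refl
  permCount≡qfact (suc n) t = begin
    + permCount (suc n) t
      ≡⟨ cong +_ (permCount-suc n t) ⟩
    + ∑Fin {suc n} (λ x → iverson (toℕ x ≤? t) Data.Nat.* permCount n (t ∸ toℕ x))
      ≡⟨ +∑Fin≡∑< (suc n) (λ i → iverson (i ≤? t) Data.Nat.* permCount n (t ∸ i)) ⟩
    ∑[ i < suc n ] + (iverson (i ≤? t) Data.Nat.* permCount n (t ∸ i))
      ≡⟨ ∑-cong (suc n) (λ i → trans (ℤ.pos-* (iverson (i ≤? t)) (permCount n (t ∸ i)))
                                     (cong₂ _*_ (+iverson-≤≡qintˢ i t) (permCount≡qfact n (t ∸ i)))) ⟩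
    ∑[ i < suc n ] (qintˢ (suc t) i * qfactˢ n (t ∸ i))
      ≡⟨ ∑-qintˢ-comm (suc t) (suc n) (λ i → qfactˢ n (t ∸ i)) ⟩
    ∑[ i < suc t ] (qintˢ (suc n) i * qfactˢ n (t ∸ i))
      ≡⟨ ⊠-as-∑ (qintˢ (suc n)) (qfactˢ n) t ⟨
    (qintˢ (suc n) ⊠ qfactˢ n) t
      ≡⟨ ⊠-comm (qintˢ (suc n)) (qfactˢ n) t ⟩
    qfactˢ (suc n) t ∎
    where open ≡-Reasoning

  I≡∑signedGauss⊠negBinomial : ∀ n t → + I n t ≡ (∑ˢ (suc n) (signedGauss n) ⊠ negBinomial n) t
  I≡∑signedGauss⊠negBinomial n t = begin
    + I n t                                       ≡⟨ cong +_ (I≡permCount n t) ⟩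
    + permCount n t                               ≡⟨ permCount≡qfact n t ⟩
    qfactˢ n t                                    ≡⟨ qfact≗qPochhammer⊠negBinomial n t ⟩
    (qPochhammer n ⊠ negBinomial n) t             ≡⟨ ⊠-congˡ (negBinomial n) (qPochhammer≗∑signedGauss n) t ⟩
    (∑ˢ (suc n) (signedGauss n) ⊠ negBinomial n) t ∎
    where open ≡-Reasoning


module CoefficientExtraction where

  open import Data.Nat using (ℕ; zero; suc; _∸_; _≤_; _<_; s≤s; _≤?_; _<?_; _⊓_)
  import Data.Nat.Properties as ℕ
  open import Data.Nat.Combinatorics using (_C_; nC1≡n; nCk+nC[k+1]≡[n+1]C[k+1]; k>n⇒nCk≡0; nCk≡nC[n∸k])
  open import Data.Integer using (ℤ; +_; _+_; _*_; -_; _-_; _⊖_)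
  import Data.Integer.Properties as ℤ
  open import Data.Bool using (true; false)
  open import Function using (id)
  open import Relation.Nullary using (Dec; yes; no)
  open import Relation.Binary.PropositionalEquality
  open import Defs using (rbinom; binomM1; Σ[_⋯_]; sign; Cnjk; gaussCoeff)
  open PowerSeries
  open PolynomialCoefficients
  open GaussianPolynomials
  open QBinomial
  open NegativeBinomial

  triangular≡C2 : ∀ j → suc j C 2 ≡ triangular j
  triangular≡C2 zero    = refl
  triangular≡C2 (suc j) = begin
    suc (suc j) C 2                ≡⟨ nCk+nC[k+1]≡[n+1]C[k+1] (suc j) 1 ⟨
    suc j C 1 Data.Nat.+ suc j C 2 ≡⟨ cong₂ Data.Nat._+_ (nC1≡n (suc j)) (triangular≡C2 j) ⟩
    triangular (suc j)             ∎
    where open ≡-Reasoning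

  rbinom-+ : ∀ x k → rbinom (+ x) k ≡ x C k
  rbinom-+ x k with k Data.Nat.≤ᵇ x
  ... | true  = refl
  ... | false = refl

  rbinom-⊖ : ∀ x y k → rbinom (x ⊖ y) (suc k) ≡ (x ∸ y) C suc k
  rbinom-⊖ x y k with y ≤? x
  ... | yes y≤x = trans (cong (λ z → rbinom z (suc k)) (ℤ.⊖-≥ y≤x)) (rbinom-+ (x ∸ y) (suc k))
  ... | no y≰x  = begin
    rbinom (x ⊖ y) (suc k)       ≡⟨ cong (λ z → rbinom z (suc k)) (ℤ.⊖-< x<y) ⟩
    rbinom (- + (y ∸ x)) (suc k) ≡⟨ negative (y ∸ x) (ℕ.m<n⇒0<n∸m x<y) ⟩
    0 C suc k                    ≡⟨ cong (_C suc k) (ℕ.m≤n⇒m∸n≡0 (ℕ.<⇒≤ x<y)) ⟨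
    (x ∸ y) C suc k              ∎
    where
    open ≡-Reasoning
    x<y : x < y
    x<y = ℕ.≰⇒> y≰x
    negative : ∀ d → 0 < d → rbinom (- + d) (suc k) ≡ 0 C suc k
    negative (suc d) _ = refl

  binomDifference : ℕ → ℕ → ℕ → ℤ
  binomDifference n t k = + rbinom ((+ t - + k) + + n) n - + rbinom (((+ t - + k) + + n) - + 1) n

  binomDifference≡ : ∀ n t k → binomDifference (suc n) t k ≡ qintˢ (suc t) k * negBinomial (suc n) (t ∸ k)
  binomDifference≡ n t k = begin
    binomDifference (suc n) t k
      ≡⟨ cong₂ (λ u v → + rbinom u (suc n) - + rbinom v (suc n)) top bottom ⟩
    + rbinom (T ⊖ k) (suc n) - + rbinom (T ⊖ suc k) (suc n)
      ≡⟨ cong₂ (λ u v → + u - + v) (rbinom-⊖ T k n) (rbinom-⊖ T (suc k) n) ⟩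
    + ((T ∸ k) C suc n) - + ((T ∸ suc k) C suc n)
      ≡⟨ by-cases (k ≤? t) ⟩
    qintˢ (suc t) k * negBinomial (suc n) (t ∸ k) ∎
    where
    open ≡-Reasoning
    T : ℕ
    T = t Data.Nat.+ suc n
    top : (+ t - + k) + + suc n ≡ T ⊖ k
    top = trans (cong (_+ + suc n) (ℤ.[+m]-[+n]≡m⊖n t k)) (ℤ.distribˡ-⊖-+-pos (suc n) t k)
    bottom : (+ t - + k) + + suc n - + 1 ≡ T ⊖ suc k
    bottom = trans (cong (_- + 1) top)
                   (trans (ℤ.distribˡ-⊖-+-neg 0 T k) (cong (λ m → T ⊖ suc m) (ℕ.+-identityʳ k)))
    by-cases : Dec (k ≤ t) →
               + ((T ∸ k) C suc n) - + ((T ∸ suc k) C suc n) ≡ qintˢ (suc t) k * negBinomial (suc n) (t ∸ k)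
    by-cases (yes k≤t) = begin
      + ((T ∸ k) C suc n) - + ((T ∸ suc k) C suc n)
        ≡⟨ cong₂ (λ u v → + (u C suc n) - + (v C suc n)) T∸k≡1+Y T∸1+k≡Y ⟩
      + (suc Y C suc n) - + (Y C suc n)
        ≡⟨ cong (λ z → + z - + (Y C suc n)) (nCk+nC[k+1]≡[n+1]C[k+1] Y n) ⟨
      + (Y C n Data.Nat.+ Y C suc n) - + (Y C suc n)
        ≡⟨ +[x+y]-y≡+x (Y C n) (Y C suc n) ⟩
      + (Y C n)
        ≡⟨ cong (λ m → + (m C n)) (ℕ.+-comm (t ∸ k) n) ⟩
      negBinomial (suc n) (t ∸ k)
        ≡⟨ ℤ.*-identityˡ _ ⟨
      + 1 * negBinomial (suc n) (t ∸ k)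
        ≡⟨ cong (_* negBinomial (suc n) (t ∸ k)) (qintˢ-≤ k≤t) ⟨
      qintˢ (suc t) k * negBinomial (suc n) (t ∸ k) ∎
      where
      Y : ℕ
      Y = (t ∸ k) Data.Nat.+ n
      T∸k≡1+Y : T ∸ k ≡ suc Y
      T∸k≡1+Y = trans (ℕ.+-∸-comm (suc n) k≤t) (ℕ.+-suc (t ∸ k) n)
      T∸1+k≡Y : T ∸ suc k ≡ Y
      T∸1+k≡Y = trans (cong (T ∸_) (ℕ.+-comm 1 k)) (trans (sym (ℕ.∸-+-assoc T k 1)) (cong (_∸ 1) T∸k≡1+Y))
    by-cases (no k≰t) = begin
      + ((T ∸ k) C suc n) - + ((T ∸ suc k) C suc n)
        ≡⟨ cong₂ (λ u v → + u - + v) (k>n⇒nCk≡0 T∸k<1+n) (k>n⇒nCk≡0 T∸1+k<1+n) ⟩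
      + 0
        ≡⟨ ℤ.*-zeroˡ (negBinomial (suc n) (t ∸ k)) ⟨
      + 0 * negBinomial (suc n) (t ∸ k)
        ≡⟨ cong (_* negBinomial (suc n) (t ∸ k)) (qintˢ-> t<k) ⟨
      qintˢ (suc t) k * negBinomial (suc n) (t ∸ k) ∎
      where
      t<k : t < k
      t<k = ℕ.≰⇒> k≰t
      T∸1+t≡n : T ∸ suc t ≡ n
      T∸1+t≡n = trans (cong (_∸ suc t) (ℕ.+-suc t n)) (ℕ.m+n∸m≡n t n)
      T∸k<1+n : T ∸ k < suc n
      T∸k<1+n = s≤s (subst (T ∸ k ≤_) T∸1+t≡n (ℕ.∸-monoʳ-≤ T t<k))
      T∸1+k<1+n : T ∸ suc k < suc n
      T∸1+k<1+n = ℕ.≤-<-trans (ℕ.∸-monoʳ-≤ T (ℕ.n≤1+n k)) T∸k<1+n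

  leadingTerm≡negBinomial : ∀ n t →
    + ((suc n Data.Nat.+ t) C t) - + binomM1 (suc n Data.Nat.+ t ∸ 1) t ≡ negBinomial (suc n) t
  leadingTerm≡negBinomial n zero    = sym (negBinomial-zero (suc n))
  leadingTerm≡negBinomial n (suc t) = begin
    + (suc X C suc t) - + (X C t)           ≡⟨ cong (λ z → + z - + (X C t)) (nCk+nC[k+1]≡[n+1]C[k+1] X t) ⟨
    + (X C t Data.Nat.+ X C suc t) - + (X C t)
      ≡⟨ cong (_- + (X C t)) (cong +_ (ℕ.+-comm (X C t) (X C suc t))) ⟩
    + (X C suc t Data.Nat.+ X C t) - + (X C t) ≡⟨ +[x+y]-y≡+x (X C suc t) (X C t) ⟩
    + (X C suc t)                           ≡⟨ cong +_ (nCk≡nC[n∸k] (ℕ.m≤n+m (suc t) n)) ⟩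
    + (X C (X ∸ suc t))                     ≡⟨ cong (λ m → + (X C m)) (ℕ.m+n∸n≡m n (suc t)) ⟩
    + (X C n)                               ∎
    where
    open ≡-Reasoning
    X : ℕ
    X = n Data.Nat.+ suc t

  -- Every k ≤ t with k ≥ a lies in the window [a, b], so the sum is the whole convolution.
  ∑-truncated-convolution : ∀ (e h : Series) a b t → t ≤ b →
    ∑[ i < suc b ∸ a ] (h i * (qintˢ (suc t) (a Data.Nat.+ i) * e (t ∸ (a Data.Nat.+ i)))) ≡ shiftBy a (h ⊠ e) t
  ∑-truncated-convolution e h a b t t≤b with t <? a
  ... | yes t<a = begin
    ∑[ i < N ] (h i * (qintˢ (suc t) (a Data.Nat.+ i) * e (t ∸ (a Data.Nat.+ i))))
      ≡⟨ ∑-cong N (λ i → cong (h i *_) (trans (cong (_* e (t ∸ (a Data.Nat.+ i)))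
                                                      (qintˢ-> (ℕ.<-≤-trans t<a (ℕ.m≤m+n a i))))
                                               (ℤ.*-zeroˡ (e (t ∸ (a Data.Nat.+ i)))))) ⟩
    ∑[ i < N ] (h i * + 0)     ≡⟨ ∑-cong N (λ i → ℤ.*-zeroʳ (h i)) ⟩
    ∑[ i < N ] + 0             ≡⟨ ∑-zero N ⟩
    + 0                        ≡⟨ shiftBy-< a (h ⊠ e) t<a ⟨
    shiftBy a (h ⊠ e) t        ∎
    where
    open ≡-Reasoning
    N : ℕ
    N = suc b ∸ a
  ... | no t≮a = subst (λ t → ∑[ i < N ] (h i * (qintˢ (suc t) (a Data.Nat.+ i) * e (t ∸ (a Data.Nat.+ i))))
                              ≡ shiftBy a (h ⊠ e) t) a+m≡t (begin
    ∑[ i < N ] (h i * (qintˢ (suc (a Data.Nat.+ m)) (a Data.Nat.+ i) * e (a Data.Nat.+ m ∸ (a Data.Nat.+ i))))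
      ≡⟨ ∑-cong N (λ i → trans (cong₂ (λ u v → h i * (u * e v)) (qintˢ-shift a m i) (ℕ.[m+n]∸[m+o]≡n∸o a m i))
                               (exchange (h i) (qintˢ (suc m) i) (e (m ∸ i)))) ⟩
    ∑[ i < N ] (qintˢ (suc m) i * (h i * e (m ∸ i)))
      ≡⟨ ∑-qintˢ (suc m) N (λ i → h i * e (m ∸ i)) ⟩
    ∑< (suc m ⊓ N) (λ i → h i * e (m ∸ i))
      ≡⟨ cong (λ l → ∑< l (λ i → h i * e (m ∸ i))) (ℕ.m≤n⇒m⊓n≡m 1+m≤N) ⟩
    ∑[ i < suc m ] (h i * e (m ∸ i))
      ≡⟨ ⊠-as-∑ h e m ⟨
    (h ⊠ e) m
      ≡⟨ shiftBy-+ˡ a (h ⊠ e) m ⟨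
    shiftBy a (h ⊠ e) (a Data.Nat.+ m) ∎)
    where
    open ≡-Reasoning
    N : ℕ
    N = suc b ∸ a
    m : ℕ
    m = t ∸ a
    a≤t : a ≤ t
    a≤t = ℕ.≮⇒≥ t≮a
    a+m≡t : a Data.Nat.+ m ≡ t
    a+m≡t = ℕ.m+[n∸m]≡n a≤t
    1+m≤N : suc m ≤ N
    1+m≤N = subst (suc m ≤_) (sym (ℕ.+-∸-assoc 1 (ℕ.≤-trans a≤t t≤b))) (s≤s (ℕ.∸-monoˡ-≤ a t≤b))
    exchange : ∀ x y z → x * (y * z) ≡ y * (x * z)
    exchange x y z = trans (sym (ℤ.*-assoc x y z)) (trans (cong (_* z) (ℤ.*-comm x y)) (ℤ.*-assoc y x z))


  nC2≤triangular : ∀ n → n C 2 ≤ triangular n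
  nC2≤triangular n = subst (n C 2 ≤_) (trans (nCk+nC[k+1]≡[n+1]C[k+1] n 1) (triangular≡C2 n)) (ℕ.m≤n+m (n C 2) (n C 1))

  Σ≡signedGauss⊠negBinomial : ∀ n′ j t → let n = suc n′ in j ≤ n → t ≤ triangular n →
    Σ[ suc j C 2 ⋯ suc n C 2 ] (λ k → sign j * Cnjk n j k * binomDifference n t k)
      ≡ (signedGauss n j ⊠ negBinomial n) t
  Σ≡signedGauss⊠negBinomial n′ j t j≤n t≤ = begin
    Σ[ a ⋯ b ] (λ k → sign j * Cnjk n j k * binomDifference n t k)
      ≡⟨ foldr-+-applyUpTo (λ i → sign j * Cnjk n j (a Data.Nat.+ i) * binomDifference n t (a Data.Nat.+ i)) id (suc b ∸ a) ⟩
    ∑[ i < suc b ∸ a ] (sign j * Cnjk n j (a Data.Nat.+ i) * binomDifference n t (a Data.Nat.+ i))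
      ≡⟨ ∑-cong (suc b ∸ a) summand ⟩
    ∑[ i < suc b ∸ a ] (sign j * (gauss n j i * (qintˢ (suc t) (a Data.Nat.+ i) * negBinomial n (t ∸ (a Data.Nat.+ i)))))
      ≡⟨ *-distribˡ-∑ (sign j) (suc b ∸ a) _ ⟩
    sign j * (∑[ i < suc b ∸ a ] (gauss n j i * (qintˢ (suc t) (a Data.Nat.+ i) * negBinomial n (t ∸ (a Data.Nat.+ i)))))
      ≡⟨ cong (sign j *_) (∑-truncated-convolution (negBinomial n) (gauss n j) a b t
                                                   (subst (t ≤_) (sym (triangular≡C2 n)) t≤)) ⟩
    sign j * shiftBy a (gauss n j ⊠ negBinomial n) t
      ≡⟨ cong (λ m → sign j * shiftBy m (gauss n j ⊠ negBinomial n) t) (triangular≡C2 j) ⟩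
    sign j * shiftBy (triangular j) (gauss n j ⊠ negBinomial n) t
      ≡⟨ cong (sign j *_) (shiftBy-⊠ (triangular j) (gauss n j) (negBinomial n) t) ⟨
    (sign j · (shiftBy (triangular j) (gauss n j) ⊠ negBinomial n)) t
      ≡⟨ ·-⊠-assoc (sign j) (shiftBy (triangular j) (gauss n j)) (negBinomial n) t ⟨
    (signedGauss n j ⊠ negBinomial n) t ∎
    where
    open ≡-Reasoning
    n : ℕ
    n = suc n′
    a : ℕ
    a = suc j C 2
    b : ℕ
    b = suc n C 2
    summand : ∀ i → sign j * Cnjk n j (a Data.Nat.+ i) * binomDifference n t (a Data.Nat.+ i)
                  ≡ sign j * (gauss n j i * (qintˢ (suc t) (a Data.Nat.+ i) * negBinomial n (t ∸ (a Data.Nat.+ i))))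
    summand i = trans (cong₂ (λ u v → sign j * u * v)
                             (trans (cong (gaussCoeff n j) (ℕ.m+n∸m≡n a i)) (gaussCoeff≡gauss j≤n i))
                             (binomDifference≡ n′ t (a Data.Nat.+ i)))
                      (ℤ.*-assoc (sign j) (gauss n j i) _)


open import Defs
open import Data.Nat using (ℕ; suc; _≤_; _∸_)
open import Data.Nat.Combinatorics using (_C_)
open import Data.Integer using (ℤ; +_; _-_; _*_)
open import Relation.Binary.PropositionalEquality using (_≡_)

open import Data.Nat using (s≤s; z≤n)
import Data.Nat.Properties as ℕ
open import Function using (id)
open import Relation.Binary.PropositionalEquality using (sym; trans; cong; cong₂; module ≡-Reasoning)
open PowerSeries
open PolynomialCoefficients using (foldr-+-applyUpTo)
open QBinomial using (triangular; signedGauss; signedGauss-n0)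
open NegativeBinomial using (negBinomial)
open InversionGeneratingFunction using (I≡∑signedGauss⊠negBinomial)
open CoefficientExtraction

corollary3p4 : (n t : ℕ) → 1 ≤ n → t ≤ n C 2 →
    + I n t ≡
      (+ ((n Data.Nat.+ t) C t) - + binomM1 (n Data.Nat.+ t ∸ 1) t)
      Data.Integer.+ Σ[ 1 ⋯ n ] (λ j →
          Σ[ suc j C 2 ⋯ suc n C 2 ] (λ k →
            sign j * Cnjk n j k
              * (+ rbinom ((+ t - + k) Data.Integer.+ + n) n
                 - + rbinom (((+ t - + k) Data.Integer.+ + n) - + 1) n)))
corollary3p4 n@(suc n′) t (s≤s z≤n) t≤nC2 = begin
  + I n t
    ≡⟨ I≡∑signedGauss⊠negBinomial n t ⟩
  (∑ˢ (suc n) (signedGauss n) ⊠ negBinomial n) t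
    ≡⟨ ∑ˢ-⊠ (suc n) (signedGauss n) (negBinomial n) t ⟩
  (signedGauss n 0 ⊠ negBinomial n) t Data.Integer.+ (∑[ i < n ] (signedGauss n (suc i) ⊠ negBinomial n) t)
    ≡⟨ cong₂ Data.Integer._+_ leading (∑-cong< n (λ i i<n → sym (Σ≡signedGauss⊠negBinomial n′ (suc i) t i<n t≤triangular))) ⟩
  leadingTerm Data.Integer.+ (∑[ i < n ] innerSum (suc i))
    ≡⟨ cong (λ x → leadingTerm Data.Integer.+ x) (foldr-+-applyUpTo (λ i → innerSum (suc i)) id n) ⟨
  leadingTerm Data.Integer.+ Σ[ 1 ⋯ n ] innerSum ∎
  where
  open ≡-Reasoning
  leadingTerm : ℤ
  leadingTerm = + ((n Data.Nat.+ t) C t) - + binomM1 (n Data.Nat.+ t ∸ 1) t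
  innerSum : ℕ → ℤ
  innerSum j = Σ[ suc j C 2 ⋯ suc n C 2 ] (λ k → sign j * Cnjk n j k * binomDifference n t k)
  t≤triangular : t ≤ triangular n
  t≤triangular = ℕ.≤-trans t≤nC2 (nC2≤triangular n)
  leading : (signedGauss n 0 ⊠ negBinomial n) t ≡ leadingTerm
  leading = trans (⊠-congˡ (negBinomial n) (signedGauss-n0 n) t)
                  (trans (⊠-identityˡ (negBinomial n) t) (sym (leadingTerm≡negBinomial n′ t)))
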